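{- Let $n\ge1$, let $k$ be a nonnegative integer and let $C\subseteq C^n$. The following four conditions are equivalent: (1) $C$ is a $k$-subcube of $C^n$; (2) $|C|=2^k$ and $\dim(\mathrm{aff}(C))=k$; (3) $C$ is a flat of $M(C^n)$ of rank $k+1$ having the maximum number of elements among flats of rank $k+1$; (4) $C=C(\mathbf v;I_1,\dots,I_k)$ for some vertex $\mathbf v\in C^n$ and some pairwise disjoint nonempty subsets $I_1,\dots,I_k$ of $[n]$.
   Context: $C^n=\{ -1,1\}^n\subseteq\mathbb R^n$, $[n]=\{1,\dots,n\}$. $M(C^n)$ is the matroid of affine dependencies of $C^n$ over $\mathbb R$ (independent sets = affinely independent subsets); the rank of $A\subseteq C^n$ is $\dim(\mathrm{aff}(A))+1$. A $k$-subcube of $C^n$ is a subset $C\subseteq C^n$ whose matroid of affine dependencies over $\mathbb R$ is isomorphic to $M(C^k)$. For $\mathbf v\in C^n$ and $I\subseteq[n]$, $\mathbf v(I)\in\mathbb R^n$ is the vector obtained from $\mathbf v$ by replacing by $0$ the entries indexed by $[n]\setminus I$. For pairwise disjoint nonempty $I_1,\dots,I_k\subseteq[n]$ and $J=[n]\setminus(I_1\cup\dots\cup I_k)$, $C(\mathbf v;I_1,\dots,I_k)=\{\epsilon_1\mathbf v(I_1)+\dots+\epsilon_k\mathbf v(I_k)+\mathbf v(J):\epsilon_1,\dots,\epsilon_k\in\{ -1,1\}\}$. -}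

module Defs where

open import Data.Bool using (Bool; true; false; _∨_; not; if_then_else_)
open import Data.Nat using (ℕ; zero; suc; _≤_)
open import Data.Fin using (Fin; zero; suc)
open import Data.Fin.Subset using (Subset; _∪_; ⊥; ∁)
open import Data.List using (List; []; _∷_; length; map; _++_; filterᵇ; foldr; allFin)
open import Data.List.Relation.Unary.All using (All)
open import Data.Vec using (Vec; []; _∷_; replicate; zipWith; lookup; tabulate)
import Data.Vec.Properties as VecP
import Data.Bool.Properties as BoolP
open import Data.Rational using (ℚ; 0ℚ; 1ℚ; -_; _+_; _*_)
open import Data.Product using (Σ; ∃; _×_; _,_)
open import Relation.Binary.PropositionalEquality using (_≡_)
open import Relation.Nullary.Decidable using (⌊_⌋)

-- Vertices of C^n = {-1,1}^n, coded by sign vectors (true ↦ 1, false ↦ -1).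
Cube : ℕ → Set
Cube n = Vec Bool n

sgn : Bool → ℚ
sgn true  = 1ℚ
sgn false = - 1ℚ

-- The point of ℝ^n (here ℚ^n) represented by a vertex.
pt : ∀ {n} → Cube n → Vec ℚ n
pt v = Data.Vec.map sgn v

allCube : (n : ℕ) → List (Cube n)
allCube zero    = [] ∷ []
allCube (suc n) = map (true ∷_) (allCube n) ++ map (false ∷_) (allCube n)

CubeSet : ℕ → Set
CubeSet n = Cube n → Bool

card : ∀ {n} → CubeSet n → ℕ
card {n} A = length (filterᵇ A (allCube n))

_=ᶜ_ : ∀ {n} → Cube n → Cube n → Bool
x =ᶜ y = ⌊ VecP.≡-dec BoolP._≟_ x y ⌋

insert : ∀ {n} → Cube n → CubeSet n → CubeSet n
insert x A y = (y =ᶜ x) ∨ A y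

zeroV : ∀ {n} → Vec ℚ n
zeroV = replicate _ 0ℚ

_+V_ : ∀ {n} → Vec ℚ n → Vec ℚ n → Vec ℚ n
_+V_ = zipWith _+_

_·V_ : ∀ {n} → ℚ → Vec ℚ n → Vec ℚ n
c ·V p = Data.Vec.map (c *_) p

lincomb : ∀ {n} (ps : List (Vec ℚ n)) → (Fin (length ps) → ℚ) → Vec ℚ n
lincomb []       c = zeroV
lincomb (p ∷ ps) c = (c zero ·V p) +V lincomb ps (λ i → c (suc i))

coefSum : ∀ {n} (ps : List (Vec ℚ n)) → (Fin (length ps) → ℚ) → ℚ
coefSum []       c = 0ℚ
coefSum (p ∷ ps) c = c zero + coefSum ps (λ i → c (suc i))

-- Affine independence of a finite sequence of points: the only affine
-- dependency (Σ c_i p_i = 0, Σ c_i = 0) is the trivial one.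
-- (A sequence with a repeated point is never affinely independent.)
AffIndep : ∀ {n} → List (Vec ℚ n) → Set
AffIndep ps = ∀ (c : Fin (length ps) → ℚ) →
  coefSum ps c ≡ 0ℚ → lincomb ps c ≡ zeroV → ∀ i → c i ≡ 0ℚ

-- Independent sets of M(C^n): affinely independent (lists of distinct) vertices.
Indep : ∀ {n} → List (Cube n) → Set
Indep L = AffIndep (map pt L)

_⊆ₗ_ : ∀ {n} → List (Cube n) → CubeSet n → Set
L ⊆ₗ A = All (λ x → A x ≡ true) L

HasRank : ∀ {n} → CubeSet n → ℕ → Set
HasRank {n} A r =
  (Σ (List (Cube n)) λ L → L ⊆ₗ A × Indep L × length L ≡ r) ×
  (∀ (L : List (Cube n)) → L ⊆ₗ A → Indep L → length L ≤ r)

IsFlat : ∀ {n} → CubeSet n → Set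
IsFlat A = ∀ (x : Cube _) (r : ℕ) → HasRank A r → HasRank (insert x A) r → A x ≡ true

Elem : ∀ {n} → CubeSet n → Set
Elem {n} C = Σ (Cube n) λ y → C y ≡ true

-- k-subcube: M(C) (restriction of M(C^n) to C) is isomorphic to M(C^k):
-- a bijection C^k → C mapping independent sets exactly to independent sets.
open import Function.Bundles using (_⤖_; _⇔_; module Bijection)
import Data.Product as P

IsSubcube : ∀ {n} (k : ℕ) → CubeSet n → Set
IsSubcube {n} k C = Σ (Cube k ⤖ Elem C) λ φ →
  ∀ (L : List (Cube k)) → Indep L ⇔ Indep (map (λ x → P.proj₁ (Bijection.to φ x)) L)

restrict : ∀ {n} → Cube n → Subset n → Vec ℚ n
restrict v I = tabulate λ i → if lookup I i then sgn (lookup v i) else 0ℚ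

-- The point ε_1 v(I_1) + ... + ε_k v(I_k) + v(J), J = [n] \ (I_1 ∪ ... ∪ I_k).
subcubePoint : ∀ {n k} → Cube n → (Fin k → Subset n) → (Fin k → Bool) → Vec ℚ n
subcubePoint {n} {k} v I ε =
  foldr (λ j acc → (sgn (ε j) ·V restrict v (I j)) +V acc)
        (restrict v (∁ (foldr (λ j acc → I j ∪ acc) ⊥ (allFin k))))
        (allFin k)

InSubcubeOf : ∀ {n k} → Cube n → (Fin k → Subset n) → Cube n → Set
InSubcubeOf {k = k} v I y = ∃ λ (ε : Fin k → Bool) → pt y ≡ subcubePoint v I ε

-- Split C ⊆ Cⁿ into its two slices along the first coordinate. A point of one slice is affinely
-- independent of any independent family in the other, so if C has rank k + 1 and both slices are
-- nonempty, each slice has rank at most k; by induction |C| ≤ 2^k. In the extremal case both slices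
-- have 2^(k-1) points and, by induction, the upper one is C(v; I₁, …, I_{k-1}). For a lower point z,
-- the k + 2 points z, y (a fixed lower point) and an affine basis of the upper slice cannot be
-- independent; solving the dependency shows that the lower slice is C(y; I₁, …, I_{k-1}) with y equal
-- to ±v on every block, and the first coordinate joins the coordinates where y and v still differ
-- as a new block. Conversely, C(v; I₁, …, I_k) is the image of Cᵏ under a map whose coordinates
-- are signed coordinates of its argument or constants; such a map preserves and reflects affine
-- dependencies, which gives the subcube, the rank and the size, and shows that a dependency between
-- a point and the subcube forces the point into the subcube, i.e. that the subcube is a flat.

module Submission where

open import Defs
open import Data.Bool using (Bool; true; false; not; _∧_; _∨_; T; if_then_else_)
import Data.Bool.Properties as BoolP
open import Data.Nat as ℕ using (ℕ; zero; suc; _≤_; _<_; _^_; z≤n; s≤s)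
import Data.Nat.Properties as ℕP
open import Data.Fin as Fin using (Fin; zero; suc; punchIn; cast)
import Data.Fin.Properties as FinP
open import Data.Rational using (ℚ; 0ℚ; 1ℚ; -_; _+_; _*_; _-_; 1/_; ≢-nonZero)
import Data.Rational.Properties as ℚP
open import Data.Rational.Solver using (module +-*-Solver)
open import Data.List as List using (List; []; _∷_; length)
import Data.List.Properties as ListP
open import Data.List.Relation.Unary.All as All using (All; []; _∷_)
import Data.List.Relation.Unary.All.Properties as AllP
open import Data.List.Membership.Propositional using (_∈_)
import Data.List.Membership.Propositional.Properties as ∈P
open import Data.List.Membership.Propositional.Properties using (∈-lookup)
open import Data.List.Membership.Propositional.Properties.WithK using (unique∧set⇒bag)
open import Data.List.Relation.Binary.BagAndSetEquality using (∼bag⇒↭)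
open import Data.List.Relation.Binary.Permutation.Propositional.Properties using (↭-length)
open import Data.List.Relation.Unary.Any using (here; there)
open import Data.List.Relation.Unary.Unique.Propositional using (Unique)
import Data.List.Relation.Unary.Unique.Propositional.Properties as UniqueP
open import Data.List.Relation.Unary.AllPairs using ([]; _∷_)
open import Data.Vec as Vec using (Vec; []; _∷_; lookup)
import Data.Vec.Properties as VecP
open import Data.Vec.Relation.Binary.Pointwise.Extensional using (ext; Pointwise-≡⇒≡)
open import Data.Fin.Subset as Subset using (Subset; Nonempty; Empty; _∩_; _∪_; ∁; ⁅_⁆)
import Data.Fin.Subset.Properties as SubsetP
open import Data.Vec.Functional using (insertAt) renaming (_∷_ to _∷ᶠ_)
open import Data.Vec.Functional.Properties using (insertAt-lookup; insertAt-punchIn)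
open import Data.Product using (Σ; ∃; _×_; _,_; proj₁; proj₂)
open import Data.Sum using (_⊎_; inj₁; inj₂)
open import Data.Empty using (⊥-elim)
open import Function.Base using (_∘_)
open import Function.Bundles using (_⇔_; mk⇔; module Equivalence; _⤖_; mk⤖; module Bijection)
import Function.Properties.Equivalence as ⇔
open import Relation.Binary.PropositionalEquality
  using (_≡_; _≢_; refl; sym; trans; cong; cong₂; subst; module ≡-Reasoning)
open import Relation.Nullary using (¬_; Dec; yes; no)
open import Relation.Nullary.Decidable using (¬?; T?; isYes≗does; dec-true; toWitness)
open import Axiom.UniquenessOfIdentityProofs using (module Decidable⇒UIP)

open import Algebra.Bundles using (Ring)
open import Algebra.Properties.Semiring.Sum (Ring.semiring ℚP.+-*-ring)
  using (sum; sum-syntax; sum-cong-≗; sum-replicate-zero; sum-remove; ∑-distrib-+; *-distribˡ-sum; *-distribʳ-sum)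
open import Algebra.Properties.Group ℚP.+-0-group using (x∙y⁻¹≈ε⇒x≈y)

open +-*-Solver
open ≡-Reasoning

-- Signs and rational arithmetic

xnor : Bool → Bool → Bool
xnor true  b = b
xnor false b = not b

sgn-xnor : ∀ a b → sgn (xnor a b) ≡ sgn a * sgn b
sgn-xnor true  true  = refl
sgn-xnor true  false = refl
sgn-xnor false true  = refl
sgn-xnor false false = refl

sgn*sgn≡1 : ∀ b → sgn b * sgn b ≡ 1ℚ
sgn*sgn≡1 true  = refl
sgn*sgn≡1 false = refl

sgn-not : ∀ b → sgn (not b) ≡ - sgn b
sgn-not true  = refl
sgn-not false = refl

sgn≢0 : ∀ b → sgn b ≢ 0ℚ
sgn≢0 true  ()
sgn≢0 false ()

sgn-injective : ∀ {a b} → sgn a ≡ sgn b → a ≡ b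
sgn-injective {true}  {true}  _ = refl
sgn-injective {true}  {false} ()
sgn-injective {false} {true}  ()
sgn-injective {false} {false} _ = refl

xnor-injectiveˡ : ∀ {a a′} b → xnor a b ≡ xnor a′ b → a ≡ a′
xnor-injectiveˡ {true}  {true}  b _ = refl
xnor-injectiveˡ {false} {false} b _ = refl
xnor-injectiveˡ {true}  {false} true  ()
xnor-injectiveˡ {true}  {false} false ()
xnor-injectiveˡ {false} {true}  true  ()
xnor-injectiveˡ {false} {true}  false ()

xnor-transpose : ∀ {a b c} → xnor a b ≡ c → a ≡ xnor c b
xnor-transpose {true}  {true}  refl = refl
xnor-transpose {true}  {false} refl = refl
xnor-transpose {false} {true}  refl = refl
xnor-transpose {false} {false} refl = refl

sgn≡sgn*sgn-xnor : ∀ a b → sgn a ≡ sgn b * sgn (xnor a b)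
sgn≡sgn*sgn-xnor true  true  = refl
sgn≡sgn*sgn-xnor true  false = refl
sgn≡sgn*sgn-xnor false true  = refl
sgn≡sgn*sgn-xnor false false = refl

xnor-self : ∀ b → xnor b b ≡ true
xnor-self true  = refl
xnor-self false = refl

xnor-not-self : ∀ b → xnor (not b) b ≡ false
xnor-not-self true  = refl
xnor-not-self false = refl

xnor-identityʳ : ∀ a → xnor a true ≡ a
xnor-identityʳ true  = refl
xnor-identityʳ false = refl

xnor-assoc : ∀ a b c → xnor (xnor a b) c ≡ xnor a (xnor b c)
xnor-assoc true  b     c     = refl
xnor-assoc false true  c     = refl
xnor-assoc false false true  = refl
xnor-assoc false false false = refl

xnor-cancel-middle : ∀ a s v → xnor (xnor a s) (xnor s v) ≡ xnor a v
xnor-cancel-middle a s v = begin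
  xnor (xnor a s) (xnor s v) ≡⟨ xnor-assoc a s (xnor s v) ⟩
  xnor a (xnor s (xnor s v)) ≡⟨ cong (xnor a) (sym (xnor-assoc s s v)) ⟩
  xnor a (xnor (xnor s s) v) ≡⟨ cong (λ b → xnor a (xnor b v)) (xnor-self s) ⟩
  xnor a v                   ∎

xnor-involutive : ∀ a b → xnor a (xnor a b) ≡ b
xnor-involutive a b = xnor-cancel-middle true a b

true≢false : true ≢ false
true≢false ()

x-y≡0⇒x≡y : ∀ x y → x - y ≡ 0ℚ → x ≡ y
x-y≡0⇒x≡y = x∙y⁻¹≈ε⇒x≈y

x+y≡0⇒x≡-y : ∀ x y → x + y ≡ 0ℚ → x ≡ - y
x+y≡0⇒x≡-y x y e = begin
  x             ≡⟨ solve 2 (λ x y → x := (x :+ y) :- y) refl x y ⟩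
  (x + y) - y   ≡⟨ cong (_- y) e ⟩
  0ℚ - y        ≡⟨ ℚP.+-identityˡ (- y) ⟩
  - y           ∎

*-cancelˡ-≡0 : ∀ c x → c ≢ 0ℚ → c * x ≡ 0ℚ → x ≡ 0ℚ
*-cancelˡ-≡0 c x c≢0 e = begin
  x                  ≡⟨ sym (ℚP.*-identityˡ x) ⟩
  1ℚ * x             ≡⟨ cong (_* x) (sym (ℚP.*-inverseˡ c)) ⟩
  (c⁻¹ * c) * x      ≡⟨ ℚP.*-assoc c⁻¹ c x ⟩
  c⁻¹ * (c * x)      ≡⟨ cong (c⁻¹ *_) e ⟩
  c⁻¹ * 0ℚ           ≡⟨ ℚP.*-zeroʳ c⁻¹ ⟩
  0ℚ                 ∎
  where
  instance _ = ≢-nonZero c≢0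
  c⁻¹ = 1/ c

*-cancelˡ-≡ : ∀ c a b → c ≢ 0ℚ → c * a ≡ c * b → a ≡ b
*-cancelˡ-≡ c a b c≢0 e = x-y≡0⇒x≡y a b (*-cancelˡ-≡0 c (a - b) c≢0 (begin
  c * (a - b)       ≡⟨ solve 3 (λ c a b → c :* (a :- b) := c :* a :- c :* b) refl c a b ⟩
  c * a - c * b     ≡⟨ cong (_- c * b) e ⟩
  c * b - c * b     ≡⟨ ℚP.+-inverseʳ (c * b) ⟩
  0ℚ                ∎))

x+x≡0⇒x≡0 : ∀ x → x + x ≡ 0ℚ → x ≡ 0ℚ
x+x≡0⇒x≡0 x e = *-cancelˡ-≡0 (1ℚ + 1ℚ) x (λ ())
  (trans (solve 1 (λ x → (con 1ℚ :+ con 1ℚ) :* x := x :+ x) refl x) e)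

a≡0∧a+b≡0⇒b≡0 : ∀ {a b} → a ≡ 0ℚ → a + b ≡ 0ℚ → b ≡ 0ℚ
a≡0∧a+b≡0⇒b≡0 {a} {b} a≡0 a+b≡0 = trans (sym (ℚP.+-identityˡ b)) (trans (cong (_+ b) (sym a≡0)) a+b≡0)

c*sgn*sgn-cancel : ∀ c a b a′ b′ → c ≢ 0ℚ → (c * sgn a) * sgn b ≡ (c * sgn a′) * sgn b′ → xnor a b ≡ xnor a′ b′
c*sgn*sgn-cancel c a b a′ b′ c≢0 e = sgn-injective (*-cancelˡ-≡ c _ _ c≢0 (begin
  c * sgn (xnor a b)      ≡⟨ cong (c *_) (sgn-xnor a b) ⟩
  c * (sgn a * sgn b)     ≡⟨ sym (ℚP.*-assoc c (sgn a) (sgn b)) ⟩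
  (c * sgn a) * sgn b     ≡⟨ e ⟩
  (c * sgn a′) * sgn b′   ≡⟨ ℚP.*-assoc c (sgn a′) (sgn b′) ⟩
  c * (sgn a′ * sgn b′)   ≡⟨ cong (c *_) (sym (sgn-xnor a′ b′)) ⟩
  c * sgn (xnor a′ b′)    ∎))

sgn-difference≡0 : ∀ a b s → (sgn a - sgn b) * sgn s ≡ 0ℚ → a ≡ b
sgn-difference≡0 a b s e = sgn-injective (x-y≡0⇒x≡y _ _ (*-cancelˡ-≡0 (sgn s) _ (sgn≢0 s) (trans (ℚP.*-comm (sgn s) _) e)))

sgn-difference-self : ∀ a s → (sgn a - sgn a) * sgn s ≡ 0ℚ
sgn-difference-self a s = solve 2 (λ a s → (a :- a) :* s := con 0ℚ) refl (sgn a) (sgn s)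

sgn-difference-xnor : ∀ a b s a′ b′ s′ → (sgn a - sgn b) * sgn s ≡ (sgn a′ - sgn b′) * sgn s′ → xnor a b ≡ xnor a′ b′
sgn-difference-xnor a b s a′ b′ s′ e with a BoolP.≟ b | a′ BoolP.≟ b′
... | yes refl | yes refl = trans (xnor-self a) (sym (xnor-self a′))
... | yes refl | no a′≢b′ = ⊥-elim (a′≢b′ (sgn-difference≡0 a′ b′ s′ (trans (sym e) (sgn-difference-self a s))))
... | no a≢b   | yes refl = ⊥-elim (a≢b (sgn-difference≡0 a b s (trans e (sgn-difference-self a′ s′))))
... | no a≢b   | no a′≢b′ rewrite BoolP.¬-not a≢b | BoolP.¬-not a′≢b′ = trans (xnor-not-self b) (sym (xnor-not-self b′))

sgn-flip-xnor : ∀ a s a′ s′ → (sgn (not a) - sgn a) * sgn s ≡ (sgn (not a′) - sgn a′) * sgn s′ → xnor a s ≡ xnor a′ s′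
sgn-flip-xnor a s a′ s′ e = sgn-injective (*-cancelˡ-≡ (- (1ℚ + 1ℚ)) _ _ (λ ()) (trans (flip a s) (trans e (sym (flip a′ s′)))))
  where
  flip : ∀ a s → - (1ℚ + 1ℚ) * sgn (xnor a s) ≡ (sgn (not a) - sgn a) * sgn s
  flip a s = begin
    - (1ℚ + 1ℚ) * sgn (xnor a s)       ≡⟨ cong (- (1ℚ + 1ℚ) *_) (sgn-xnor a s) ⟩
    - (1ℚ + 1ℚ) * (sgn a * sgn s)      ≡⟨ solve 2 (λ x s → (:- (con 1ℚ :+ con 1ℚ)) :* (x :* s) := ((:- x) :- x) :* s) refl (sgn a) (sgn s) ⟩
    (- sgn a - sgn a) * sgn s          ≡⟨ cong (λ z → (z - sgn a) * sgn s) (sym (sgn-not a)) ⟩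
    (sgn (not a) - sgn a) * sgn s      ∎

-- Finite sums and affine independence

sum-zero : ∀ {m} {f : Fin m → ℚ} → (∀ i → f i ≡ 0ℚ) → sum f ≡ 0ℚ
sum-zero {m} f≡0 = trans (sum-cong-≗ f≡0) (sum-replicate-zero m)

sum-delta : ∀ {m} (f : Fin m → ℚ) r → (∀ i → i ≢ r → f i ≡ 0ℚ) → sum f ≡ f r
sum-delta {suc m} f r others≡0 = begin
  sum f                             ≡⟨ sum-remove {i = r} f ⟩
  f r + ∑[ i < m ] f (punchIn r i)  ≡⟨ cong (f r +_) (sum-zero (λ i → others≡0 _ (FinP.punchInᵢ≢i r i))) ⟩
  f r + 0ℚ                          ≡⟨ ℚP.+-identityʳ (f r) ⟩
  f r                               ∎

sum-insertAt : ∀ {m} (c : Fin m → ℚ) r x (g : Fin (suc m) → ℚ) →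
  ∑[ i < suc m ] (insertAt c r x i * g i) ≡ x * g r + ∑[ i < m ] (c i * g (punchIn r i))
sum-insertAt {m} c r x g = begin
  ∑[ i < suc m ] (insertAt c r x i * g i)                   ≡⟨ sum-remove {i = r} (λ i → insertAt c r x i * g i) ⟩
  insertAt c r x r * g r + ∑[ i < m ] (insertAt c r x (punchIn r i) * g (punchIn r i))
    ≡⟨ cong₂ _+_ (cong (_* g r) (insertAt-lookup c r x))
                 (sum-cong-≗ (λ i → cong (_* g (punchIn r i)) (insertAt-punchIn c r x i))) ⟩
  x * g r + ∑[ i < m ] (c i * g (punchIn r i))              ∎

AffIndepᶠ : ∀ {m n} → (Fin m → Fin n → ℚ) → Set
AffIndepᶠ {m} {n} p = ∀ (c : Fin m → ℚ) → sum c ≡ 0ℚ →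
  (∀ t → ∑[ i < m ] (c i * p i t) ≡ 0ℚ) → ∀ i → c i ≡ 0ℚ

AffIndepᶠ-cong : ∀ {m n} {p q : Fin m → Fin n → ℚ} → (∀ i t → p i t ≡ q i t) → AffIndepᶠ p → AffIndepᶠ q
AffIndepᶠ-cong p≡q indep c Σc≡0 Σcq≡0 =
  indep c Σc≡0 (λ t → trans (sum-cong-≗ (λ i → cong (c i *_) (p≡q i t))) (Σcq≡0 t))

AffIndepᶠ-cast : ∀ {m m′ n} (e : m ≡ m′) (p : Fin m′ → Fin n → ℚ) → AffIndepᶠ p ⇔ AffIndepᶠ (p ∘ cast e)
AffIndepᶠ-cast refl p = mk⇔ (AffIndepᶠ-cong (λ i t → cong (λ j → p j t) (sym (FinP.cast-is-id refl i))))
                           (AffIndepᶠ-cong (λ i t → cong (λ j → p j t) (FinP.cast-is-id refl i)))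

AffIndepᶠ-singleton : ∀ {n} (p : Fin 1 → Fin n → ℚ) → AffIndepᶠ p
AffIndepᶠ-singleton p c Σc≡0 _ zero = trans (sym (ℚP.+-identityʳ (c zero))) Σc≡0

ColumnOf : ∀ {m n} → (Fin m → Fin n → ℚ) → (Fin m → ℚ) → Set
ColumnOf {m} {n} p col = (∃ λ (s : Fin n) → ∃ λ a → ∀ i → col i ≡ a * p i s) ⊎ (∃ λ a → ∀ i → col i ≡ a)

-- Every affine dependency of p is then one of q.
affIndepᶠ-byColumns : ∀ {m n n′} (p : Fin m → Fin n → ℚ) (q : Fin m → Fin n′ → ℚ) →
  (∀ t → ColumnOf p (λ i → q i t)) → AffIndepᶠ q → AffIndepᶠ p
affIndepᶠ-byColumns {m} p q columns indep c Σc≡0 Σcp≡0 = indep c Σc≡0 Σcq≡0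
  where
  Σcq≡0 : ∀ t → ∑[ i < m ] (c i * q i t) ≡ 0ℚ
  Σcq≡0 t with columns t
  ... | inj₁ (s , a , q≡ap) = begin
    ∑[ i < m ] (c i * q i t)        ≡⟨ sum-cong-≗ (λ i → trans (cong (c i *_) (q≡ap i))
                                         (solve 3 (λ c a x → c :* (a :* x) := a :* (c :* x)) refl (c i) a (p i s))) ⟩
    ∑[ i < m ] (a * (c i * p i s))  ≡⟨ sym (*-distribˡ-sum a (λ i → c i * p i s)) ⟩
    a * ∑[ i < m ] (c i * p i s)    ≡⟨ cong (a *_) (Σcp≡0 s) ⟩
    a * 0ℚ                          ≡⟨ ℚP.*-zeroʳ a ⟩
    0ℚ                              ∎
  ... | inj₂ (a , q≡a) = begin
    ∑[ i < m ] (c i * q i t)  ≡⟨ sum-cong-≗ (λ i → cong (c i *_) (q≡a i)) ⟩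
    ∑[ i < m ] (c i * a)      ≡⟨ sym (*-distribʳ-sum a c) ⟩
    sum c * a                 ≡⟨ cong (_* a) Σc≡0 ⟩
    0ℚ * a                    ≡⟨ ℚP.*-zeroˡ a ⟩
    0ℚ                        ∎

record LinearDependence {m d} (w : Fin m → Fin d → ℚ) : Set where
  field
    coeff           : Fin m → ℚ
    vanishes        : ∀ t → ∑[ i < m ] (coeff i * w i t) ≡ 0ℚ
    support         : Fin m
    support-nonzero : coeff support ≢ 0ℚ

dependence-dropZeroColumn : ∀ {m d} (w : Fin m → Fin (suc d) → ℚ) → (∀ i → w i zero ≡ 0ℚ) →
  LinearDependence (λ i t → w i (suc t)) → LinearDependence w
dependence-dropZeroColumn w column≡0 dep = record
  { coeff = coeff ; vanishes = vanishes′ ; support = support ; support-nonzero = support-nonzero }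
  where
  open LinearDependence dep
  vanishes′ : ∀ t → sum (λ i → coeff i * w i t) ≡ 0ℚ
  vanishes′ zero    = sum-zero (λ i → trans (cong (coeff i *_) (column≡0 i)) (ℚP.*-zeroʳ (coeff i)))
  vanishes′ (suc t) = vanishes t

-- Gaussian elimination of the first column against the pivot row r.
dependence-pivot : ∀ {m d} (w : Fin (suc m) → Fin (suc d) → ℚ) r (a≢0 : w r zero ≢ 0ℚ) →
  let instance _ = ≢-nonZero a≢0 in
  LinearDependence (λ i t → w (punchIn r i) (suc t) - ((1/ w r zero) * w (punchIn r i) zero) * w r (suc t)) →
  LinearDependence w
dependence-pivot {m} w r a≢0 dep = record
  { coeff = c ; vanishes = vanishes′ ; support = punchIn r support ; support-nonzero = nonzero }
  where
  instance _ = ≢-nonZero a≢0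
  open LinearDependence dep
  u = 1/ w r zero
  S = ∑[ i < m ] (coeff i * w (punchIn r i) zero)
  c = insertAt coeff r (- (u * S))
  vanishes′ : ∀ t → ∑[ i < suc m ] (c i * w i t) ≡ 0ℚ
  vanishes′ zero = begin
    ∑[ i < suc m ] (c i * w i zero)   ≡⟨ sum-insertAt coeff r _ (λ i → w i zero) ⟩
    - (u * S) * w r zero + S          ≡⟨ solve 3 (λ u a S → (:- (u :* S)) :* a :+ S := :- ((u :* a) :* S) :+ S) refl u (w r zero) S ⟩
    - ((u * w r zero) * S) + S        ≡⟨ cong (λ z → - (z * S) + S) (ℚP.*-inverseˡ (w r zero)) ⟩
    - (1ℚ * S) + S                    ≡⟨ solve 1 (λ S → (:- (con 1ℚ :* S)) :+ S := con 0ℚ) refl S ⟩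
    0ℚ                                ∎
  vanishes′ (suc t) = begin
    ∑[ i < suc m ] (c i * w i (suc t))                            ≡⟨ sum-insertAt coeff r _ (λ i → w i (suc t)) ⟩
    - (u * S) * b + ∑[ i < m ] (coeff i * w (punchIn r i) (suc t)) ≡⟨ cong (- (u * S) * b +_) (sum-cong-≗ (λ i →
        solve 5 (λ c x u y b → c :* x := c :* (x :- (u :* y) :* b) :+ (u :* (c :* y)) :* b) refl
                (coeff i) (w (punchIn r i) (suc t)) u (w (punchIn r i) zero) b)) ⟩
    - (u * S) * b + ∑[ i < m ] (coeff i * w′ i + (u * (coeff i * w (punchIn r i) zero)) * b)
      ≡⟨ cong (- (u * S) * b +_) (∑-distrib-+ (λ i → coeff i * w′ i) _) ⟩
    - (u * S) * b + (∑[ i < m ] (coeff i * w′ i) + ∑[ i < m ] ((u * (coeff i * w (punchIn r i) zero)) * b))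
      ≡⟨ cong₂ (λ x y → - (u * S) * b + (x + y)) (vanishes t)
               (trans (sym (*-distribʳ-sum b (λ i → u * (coeff i * w (punchIn r i) zero))))
                      (cong (_* b) (sym (*-distribˡ-sum u (λ i → coeff i * w (punchIn r i) zero))))) ⟩
    - (u * S) * b + (0ℚ + (u * S) * b)                            ≡⟨ solve 2 (λ x b → (:- x) :* b :+ (con 0ℚ :+ x :* b) := con 0ℚ) refl (u * S) b ⟩
    0ℚ                                                            ∎
    where
    b = w r (suc t)
    w′ : Fin m → ℚ
    w′ i = w (punchIn r i) (suc t) - (u * w (punchIn r i) zero) * b
  nonzero : c (punchIn r support) ≢ 0ℚ
  nonzero e = support-nonzero (trans (sym (insertAt-punchIn coeff r _ support)) e)

linearDependence : ∀ d m → d < m → (w : Fin m → Fin d → ℚ) → LinearDependence w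
linearDependence zero (suc m) _ w = record
  { coeff = λ _ → 1ℚ ; vanishes = λ () ; support = zero ; support-nonzero = λ () }
linearDependence (suc d) m d<m w with FinP.any? (λ r → ¬? (w r zero ℚP.≟ 0ℚ))
... | no noPivot = dependence-dropZeroColumn w column≡0 (linearDependence d m (ℕP.<-trans (ℕP.n<1+n d) d<m) _)
  where
  column≡0 : ∀ r → w r zero ≡ 0ℚ
  column≡0 r with w r zero ℚP.≟ 0ℚ
  ... | yes e  = e
  ... | no ≢0 = ⊥-elim (noPivot (r , ≢0))
linearDependence (suc d) (suc m) (s≤s d<m) w | yes (r , a≢0) =
  dependence-pivot w r a≢0 (linearDependence d m d<m _)

-- A linear dependency among the vectors (1, p i) is an affine dependency among the p i.
affIndepᶠ-size : ∀ {m n} (p : Fin m → Fin n → ℚ) → AffIndepᶠ p → m ≤ suc n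
affIndepᶠ-size {m} {n} p indep with m ℕ.≤? suc n
... | yes m≤1+n = m≤1+n
... | no m≰1+n = ⊥-elim (support-nonzero (indep coeff Σc≡0 (λ t → vanishes (suc t)) support))
  where
  homogenised : Fin m → Fin (suc n) → ℚ
  homogenised i zero    = 1ℚ
  homogenised i (suc t) = p i t
  open LinearDependence (linearDependence (suc n) m (ℕP.≰⇒> m≰1+n) homogenised)
  Σc≡0 : sum coeff ≡ 0ℚ
  Σc≡0 = trans (sum-cong-≗ (λ i → sym (ℚP.*-identityʳ (coeff i)))) (vanishes zero)

-- Independent lists and families of vertices

vec-ext : ∀ {A : Set} {n} {xs ys : Vec A n} → (∀ t → lookup xs t ≡ lookup ys t) → xs ≡ ys
vec-ext xs≗ys = Pointwise-≡⇒≡ (ext xs≗ys)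

coefSum≡sum : ∀ {n} (ps : List (Vec ℚ n)) c → coefSum ps c ≡ sum c
coefSum≡sum []       c = refl
coefSum≡sum (p ∷ ps) c = cong (c zero +_) (coefSum≡sum ps (λ i → c (suc i)))

lookup-lincomb : ∀ {n} (ps : List (Vec ℚ n)) c t →
  lookup (lincomb ps c) t ≡ ∑[ i < length ps ] (c i * lookup (List.lookup ps i) t)
lookup-lincomb []       c t = VecP.lookup-replicate t 0ℚ
lookup-lincomb (p ∷ ps) c t = begin
  lookup ((c zero ·V p) +V lincomb ps (c ∘ suc)) t
    ≡⟨ VecP.lookup-zipWith _+_ t (c zero ·V p) (lincomb ps (c ∘ suc)) ⟩
  lookup (c zero ·V p) t + lookup (lincomb ps (c ∘ suc)) t
    ≡⟨ cong₂ _+_ (VecP.lookup-map t (c zero *_) p) (lookup-lincomb ps (c ∘ suc) t) ⟩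
  c zero * lookup p t + ∑[ i < length ps ] (c (suc i) * lookup (List.lookup ps i) t) ∎

AffIndep⇔AffIndepᶠ : ∀ {n} (ps : List (Vec ℚ n)) → AffIndep ps ⇔ AffIndepᶠ (λ i → lookup (List.lookup ps i))
AffIndep⇔AffIndepᶠ ps = mk⇔
  (λ indep c Σc≡0 Σcp≡0 → indep c (trans (coefSum≡sum ps c) Σc≡0)
     (vec-ext (λ t → trans (lookup-lincomb ps c t) (trans (Σcp≡0 t) (sym (VecP.lookup-replicate t 0ℚ))))))
  (λ indep c Σc≡0 comb≡0 → indep c (trans (sym (coefSum≡sum ps c)) Σc≡0)
     (λ t → trans (sym (lookup-lincomb ps c t)) (trans (cong (λ x → lookup x t) comb≡0) (VecP.lookup-replicate t 0ℚ))))

Indepᶠ : ∀ {m n} → (Fin m → Cube n) → Set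
Indepᶠ X = AffIndepᶠ (λ i t → sgn (lookup (X i) t))

Indepᶠ-cong : ∀ {m n} {X Y : Fin m → Cube n} → (∀ i → X i ≡ Y i) → Indepᶠ X → Indepᶠ Y
Indepᶠ-cong X≗Y = AffIndepᶠ-cong (λ i t → cong (λ x → sgn (lookup x t)) (X≗Y i))

Indepᶠ-size : ∀ {m n} (X : Fin m → Cube n) → Indepᶠ X → m ≤ suc n
Indepᶠ-size X = affIndepᶠ-size _

Indep-tabulate : ∀ {m n} (X : Fin m → Cube n) → Indep (List.tabulate X) ⇔ Indepᶠ X
Indep-tabulate X =
  subst (λ ps → AffIndep ps ⇔ Indepᶠ X) (sym (ListP.map-tabulate X pt))
    (⇔.trans (AffIndep⇔AffIndepᶠ ps)
      (⇔.trans (AffIndepᶠ-cast (sym (ListP.length-tabulate (pt ∘ X))) _)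
        (mk⇔ (AffIndepᶠ-cong coords) (AffIndepᶠ-cong (λ i t → sym (coords i t))))))
  where
  ps = List.tabulate (pt ∘ X)
  coords : ∀ i t → lookup (List.lookup ps (cast _ i)) t ≡ sgn (lookup (X i) t)
  coords i t = trans (cong (λ x → lookup x t) (ListP.lookup-tabulate (pt ∘ X) i)) (VecP.lookup-map t sgn (X i))

Indep-map : ∀ {A : Set} {n} (g : A → Cube n) (L : List A) → Indep (List.map g L) ⇔ Indepᶠ (g ∘ List.lookup L)
Indep-map g L = subst (λ L′ → Indep L′ ⇔ Indepᶠ (g ∘ List.lookup L))
  (trans (sym (ListP.map-tabulate (List.lookup L) g)) (cong (List.map g) (ListP.tabulate-lookup L)))
  (Indep-tabulate (g ∘ List.lookup L))

Indep⇔Indepᶠ : ∀ {n} (L : List (Cube n)) → Indep L ⇔ Indepᶠ (List.lookup L)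
Indep⇔Indepᶠ L = subst (λ L′ → Indep L′ ⇔ Indepᶠ (List.lookup L)) (ListP.map-id L) (Indep-map (λ x → x) L)

RankAtMost : ∀ {n} → CubeSet n → ℕ → Set
RankAtMost {n} C r = ∀ (L : List (Cube n)) → L ⊆ₗ C → Indep L → length L ≤ r

RankAtMostᶠ : ∀ {n} → CubeSet n → ℕ → Set
RankAtMostᶠ {n} C r = ∀ {m} (X : Fin m → Cube n) → (∀ i → C (X i) ≡ true) → Indepᶠ X → m ≤ r

RankAtMost⇒RankAtMostᶠ : ∀ {n} {C : CubeSet n} {r} → RankAtMost C r → RankAtMostᶠ C r
RankAtMost⇒RankAtMostᶠ rank≤ X X⊆C indep = subst (_≤ _) (ListP.length-tabulate X)
  (rank≤ (List.tabulate X) (AllP.tabulate⁺ X⊆C) (Equivalence.from (Indep-tabulate X) indep))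

RankAtMostᶠ⇒RankAtMost : ∀ {n} {C : CubeSet n} {r} → RankAtMostᶠ C r → RankAtMost C r
RankAtMostᶠ⇒RankAtMost rank≤ L L⊆C indep =
  rank≤ (List.lookup L) (λ i → All.lookup L⊆C (∈-lookup i)) (Equivalence.to (Indep⇔Indepᶠ L) indep)

-- Counting vertices

allCube-complete : ∀ n (x : Cube n) → x ∈ allCube n
allCube-complete zero    []          = here refl
allCube-complete (suc n) (true ∷ x)  = ∈P.∈-++⁺ˡ (∈P.∈-map⁺ (true ∷_) (allCube-complete n x))
allCube-complete (suc n) (false ∷ x) =
  ∈P.∈-++⁺ʳ (List.map (true ∷_) (allCube n)) (∈P.∈-map⁺ (false ∷_) (allCube-complete n x))

∷-injectiveʳ : ∀ {n} {b : Bool} {x y : Cube n} → _≡_ {A = Cube (suc n)} (b ∷ x) (b ∷ y) → x ≡ y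
∷-injectiveʳ refl = refl

allCube-unique : ∀ n → Unique (allCube n)
allCube-unique zero    = [] ∷ []
allCube-unique (suc n) =
  UniqueP.++⁺ (UniqueP.map⁺ ∷-injectiveʳ (allCube-unique n)) (UniqueP.map⁺ ∷-injectiveʳ (allCube-unique n)) disjoint
  where
  disjoint : ∀ {v} → ¬ (v ∈ List.map (true ∷_) (allCube n) × v ∈ List.map (false ∷_) (allCube n))
  disjoint (v∈⁺ , v∈⁻) with ∈P.∈-map⁻ (true ∷_) v∈⁺ | ∈P.∈-map⁻ (false ∷_) v∈⁻
  ... | _ , _ , refl | _ , _ , ()

length-allCube : ∀ n → length (allCube n) ≡ 2 ^ n
length-allCube zero    = refl
length-allCube (suc n) = begin
  length (List.map (true ∷_) (allCube n) List.++ List.map (false ∷_) (allCube n))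
    ≡⟨ ListP.length-++ (List.map (true ∷_) (allCube n)) ⟩
  length (List.map (true ∷_) (allCube n)) ℕ.+ length (List.map (false ∷_) (allCube n))
    ≡⟨ cong₂ ℕ._+_ (ListP.length-map _ (allCube n)) (ListP.length-map _ (allCube n)) ⟩
  length (allCube n) ℕ.+ length (allCube n)
    ≡⟨ cong (λ l → l ℕ.+ l) (length-allCube n) ⟩
  2 ^ n ℕ.+ 2 ^ n
    ≡⟨ cong (2 ^ n ℕ.+_) (sym (ℕP.+-identityʳ (2 ^ n))) ⟩
  2 ^ suc n ∎

slice : ∀ {n} → Bool → CubeSet (suc n) → CubeSet n
slice b C y = C (b ∷ y)

length-filter-map : ∀ {A B : Set} (p : B → Bool) (f : A → B) xs →
  length (List.filterᵇ p (List.map f xs)) ≡ length (List.filterᵇ (p ∘ f) xs)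
length-filter-map p f []       = refl
length-filter-map p f (x ∷ xs) with p (f x)
... | true  = cong suc (length-filter-map p f xs)
... | false = length-filter-map p f xs

card-slices : ∀ {n} (C : CubeSet (suc n)) → card C ≡ card (slice true C) ℕ.+ card (slice false C)
card-slices {n} C = begin
  card C
    ≡⟨ cong length (ListP.filter-++ (T? ∘ C) (List.map (true ∷_) (allCube n)) (List.map (false ∷_) (allCube n))) ⟩
  length (List.filterᵇ C (List.map (true ∷_) (allCube n)) List.++ List.filterᵇ C (List.map (false ∷_) (allCube n)))
    ≡⟨ ListP.length-++ (List.filterᵇ C (List.map (true ∷_) (allCube n))) ⟩
  length (List.filterᵇ C (List.map (true ∷_) (allCube n))) ℕ.+ length (List.filterᵇ C (List.map (false ∷_) (allCube n)))
    ≡⟨ cong₂ ℕ._+_ (length-filter-map C (true ∷_) (allCube n)) (length-filter-map C (false ∷_) (allCube n)) ⟩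
  card (slice true C) ℕ.+ card (slice false C) ∎

card-empty : ∀ {n} (C : CubeSet n) → (∀ x → C x ≡ false) → card C ≡ 0
card-empty {n} C C≡∅ = cong length (ListP.filter-none (T? ∘ C) (All.universal (λ x → subst (λ b → ¬ T b) (sym (C≡∅ x)) (λ ())) (allCube n)))

card≤1 : (C : CubeSet 0) → card C ≤ 1
card≤1 C = ListP.length-filter (T? ∘ C) (allCube 0)

card-image : ∀ {k n} (f : Cube k → Cube n) → (∀ {x y} → f x ≡ f y → x ≡ y) → (C : CubeSet n) →
  (∀ y → C y ≡ true → ∃ λ x → f x ≡ y) → (∀ x → C (f x) ≡ true) → card C ≡ 2 ^ k
card-image {k} {n} f f-injective C C⊆im im⊆C =
  trans (↭-length (∼bag⇒↭ bag)) (trans (ListP.length-map f (allCube k)) (length-allCube k))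
  where
  same : ∀ {z} → z ∈ List.filterᵇ C (allCube n) ⇔ z ∈ List.map f (allCube k)
  same {z} = mk⇔ to from
    where
    to : z ∈ List.filterᵇ C (allCube n) → z ∈ List.map f (allCube k)
    to z∈ with C⊆im z (Equivalence.to BoolP.T-≡ (proj₂ (∈P.∈-filter⁻ (T? ∘ C) {xs = allCube n} z∈)))
    ... | x , refl = ∈P.∈-map⁺ f (allCube-complete k x)
    from : z ∈ List.map f (allCube k) → z ∈ List.filterᵇ C (allCube n)
    from z∈ with ∈P.∈-map⁻ f z∈
    ... | x , _ , refl = ∈P.∈-filter⁺ (T? ∘ C) (allCube-complete n (f x)) (Equivalence.from BoolP.T-≡ (im⊆C x))
  bag = unique∧set⇒bag (UniqueP.filter⁺ (T? ∘ C) (allCube-unique n))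
                       (UniqueP.map⁺ f-injective (allCube-unique k)) same

length-filter-mono : ∀ {A : Set} (P Q : A → Bool) → (∀ y → P y ≡ true → Q y ≡ true) → ∀ xs →
  length (List.filterᵇ P xs) ≤ length (List.filterᵇ Q xs)
length-filter-mono P Q P⇒Q [] = z≤n
length-filter-mono P Q P⇒Q (x ∷ xs) with P x | Q x | P⇒Q x
... | true  | true  | _ = s≤s (length-filter-mono P Q P⇒Q xs)
... | true  | false | Px⇒Qx with () ← Px⇒Qx refl
... | false | true  | _ = ℕP.m≤n⇒m≤1+n (length-filter-mono P Q P⇒Q xs)
... | false | false | _ = length-filter-mono P Q P⇒Q xs

length-filter-strict : ∀ {A : Set} (P Q : A → Bool) → (∀ y → P y ≡ true → Q y ≡ true) → ∀ {y} xs → y ∈ xs →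
  Q y ≡ true → P y ≡ false → length (List.filterᵇ P xs) < length (List.filterᵇ Q xs)
length-filter-strict P Q P⇒Q (x ∷ xs) (here refl) Qy Py rewrite Qy | Py = s≤s (length-filter-mono P Q P⇒Q xs)
length-filter-strict P Q P⇒Q (x ∷ xs) (there y∈) Qy Py with P x | Q x | P⇒Q x
... | true  | true  | _ = s≤s (length-filter-strict P Q P⇒Q xs y∈ Qy Py)
... | true  | false | Px⇒Qx with () ← Px⇒Qx refl
... | false | true  | _ = ℕP.m≤n⇒m≤1+n (length-filter-strict P Q P⇒Q xs y∈ Qy Py)
... | false | false | _ = length-filter-strict P Q P⇒Q xs y∈ Qy Py

⊆∧card≤⇒⊇ : ∀ {n} (A B : CubeSet n) → (∀ y → A y ≡ true → B y ≡ true) → card B ≤ card A →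
  ∀ y → B y ≡ true → A y ≡ true
⊆∧card≤⇒⊇ {n} A B A⊆B card≤ y By with A y in Ay
... | true  = refl
... | false = ⊥-elim (ℕP.<⇒≱ (length-filter-strict A B A⊆B (allCube n) (allCube-complete n y) By Ay) card≤)

inhabited? : ∀ {n} (C : CubeSet n) → (∃ λ x → C x ≡ true) ⊎ (∀ x → C x ≡ false)
inhabited? {zero} C with C [] in C[]
... | true  = inj₁ ([] , C[])
... | false = inj₂ λ { [] → C[] }
inhabited? {suc n} C with inhabited? (slice true C) | inhabited? (slice false C)
... | inj₁ (x , Cx) | _            = inj₁ (true ∷ x , Cx)
... | inj₂ _        | inj₁ (x , Cx) = inj₁ (false ∷ x , Cx)
... | inj₂ C⁺≡∅     | inj₂ C⁻≡∅     = inj₂ λ { (true ∷ x) → C⁺≡∅ x ; (false ∷ x) → C⁻≡∅ x }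

-- Rank and size of the two slices along the first coordinate

Indepᶠ-∷ : ∀ {m n} (x : Cube n) (X : Fin m → Cube n) → Indepᶠ X →
  (∀ c → sum c ≡ 0ℚ → (∀ t → ∑[ i < suc m ] (c i * sgn (lookup ((x ∷ᶠ X) i) t)) ≡ 0ℚ) → c zero ≡ 0ℚ) →
  Indepᶠ (x ∷ᶠ X)
Indepᶠ-∷ x X indepX head≡0 c Σc≡0 Σcx≡0 zero    = head≡0 c Σc≡0 Σcx≡0
Indepᶠ-∷ x X indepX head≡0 c Σc≡0 Σcx≡0 (suc i) = indepX (c ∘ suc) (a≡0∧a+b≡0⇒b≡0 c₀≡0 Σc≡0)
  (λ t → a≡0∧a+b≡0⇒b≡0 (trans (cong (_* sgn (lookup x t)) c₀≡0) (ℚP.*-zeroˡ (sgn (lookup x t)))) (Σcx≡0 t)) i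
  where c₀≡0 = head≡0 c Σc≡0 Σcx≡0

Indepᶠ-prefix : ∀ {m n} (b : Bool) (X : Fin m → Cube n) → Indepᶠ X → Indepᶠ (λ i → b ∷ X i)
Indepᶠ-prefix b X = affIndepᶠ-byColumns (λ i t → sgn (lookup (b ∷ X i) t)) (λ i t → sgn (lookup (X i) t))
  (λ t → inj₁ (suc t , 1ℚ , λ i → sym (ℚP.*-identityˡ (sgn (lookup (X i) t)))))

Indepᶠ-offFacet : ∀ {m n} (b : Bool) (x : Cube n) (X : Fin m → Cube n) → Indepᶠ X →
  Indepᶠ ((not b ∷ x) ∷ᶠ (λ i → b ∷ X i))
Indepᶠ-offFacet {m} b x X indepX = Indepᶠ-∷ (not b ∷ x) (λ i → b ∷ X i) (Indepᶠ-prefix b X indepX) head≡0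
  where
  s = sgn b
  Y = (not b ∷ x) ∷ᶠ (λ i → b ∷ X i)
  head≡0 : ∀ c → sum c ≡ 0ℚ → (∀ t → ∑[ i < suc m ] (c i * sgn (lookup (Y i) t)) ≡ 0ℚ) → c zero ≡ 0ℚ
  -- With S the total weight on X, the first coordinate gives S = c₀ and Σ c = 0 gives S = −c₀.
  head≡0 c Σc≡0 Σcx≡0 = x+x≡0⇒x≡0 c₀ (begin
    c₀ + c₀                             ≡⟨ solve 2 (λ c₀ S → c₀ :+ c₀ := (c₀ :+ S) :+ (c₀ :- S) :* con 1ℚ) refl c₀ S ⟩
    (c₀ + S) + (c₀ - S) * 1ℚ            ≡⟨ cong (λ z → (c₀ + S) + (c₀ - S) * z) (sym (sgn*sgn≡1 b)) ⟩
    (c₀ + S) + (c₀ - S) * (s * s)       ≡⟨ solve 3 (λ c₀ S s → (c₀ :+ S) :+ (c₀ :- S) :* (s :* s) :=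
                                                 (c₀ :+ S) :- (c₀ :* (:- s) :+ S :* s) :* s) refl c₀ S s ⟩
    (c₀ + S) - (c₀ * (- s) + S * s) * s ≡⟨ cong₂ (λ u v → u - v * s) Σc≡0 firstCoordinate ⟩
    0ℚ - 0ℚ * s                         ≡⟨ solve 1 (λ s → con 0ℚ :- con 0ℚ :* s := con 0ℚ) refl s ⟩
    0ℚ                                  ∎)
    where
    c₀ = c zero
    S = sum (c ∘ suc)
    firstCoordinate : c₀ * (- s) + S * s ≡ 0ℚ
    firstCoordinate = trans (cong₂ _+_ (cong (c₀ *_) (sym (sgn-not b))) (*-distribʳ-sum s (c ∘ suc))) (Σcx≡0 zero)

rankAtMostᶠ-slice : ∀ {n} {C : CubeSet (suc n)} {r} (b : Bool) → RankAtMostᶠ C r → RankAtMostᶠ (slice b C) r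
rankAtMostᶠ-slice {C = C} b rank≤ X X⊆C indep = rank≤ (λ i → b ∷ X i) X⊆C (Indepᶠ-prefix b X indep)

rankAtMostᶠ-slice-opposite : ∀ {n} {C : CubeSet (suc n)} {r} (b : Bool) (x : Cube n) → C (not b ∷ x) ≡ true →
  RankAtMostᶠ C (suc r) → RankAtMostᶠ (slice b C) r
rankAtMostᶠ-slice-opposite {C = C} b x Cx rank≤ X X⊆C indep =
  ℕ.s≤s⁻¹ (rank≤ ((not b ∷ x) ∷ᶠ (λ i → b ∷ X i)) (λ { zero → Cx ; (suc i) → X⊆C i }) (Indepᶠ-offFacet b x X indep))

rankAtMostᶠ-0⇒empty : ∀ {n} {C : CubeSet n} → RankAtMostᶠ C 0 → ∀ x → C x ≢ true
rankAtMostᶠ-0⇒empty rank≤ x Cx with () ← rank≤ (λ _ → x) (λ _ → Cx) (AffIndepᶠ-singleton (λ _ t → sgn (lookup x t)))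

card-slice-only : ∀ {n} (C : CubeSet (suc n)) b → (∀ y → slice (not b) C y ≡ false) → card C ≡ card (slice b C)
card-slice-only C true  C⁻≡∅ = trans (card-slices C) (trans (cong (card (slice true C) ℕ.+_) (card-empty _ C⁻≡∅)) (ℕP.+-identityʳ _))
card-slice-only C false C⁺≡∅ = trans (card-slices C) (cong (ℕ._+ card (slice false C)) (card-empty _ C⁺≡∅))

card≤2^rank : ∀ n k (C : CubeSet n) → RankAtMostᶠ C (suc k) → card C ≤ 2 ^ k
card≤2^rank zero    k C _     = ℕP.≤-trans (card≤1 C) (ℕP.m^n>0 2 k)
card≤2^rank (suc n) k C rank≤ with inhabited? (slice true C) | inhabited? (slice false C)
... | inj₂ C⁺≡∅ | _ = subst (_≤ 2 ^ k) (sym (card-slice-only C false C⁺≡∅))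
                              (card≤2^rank n k _ (rankAtMostᶠ-slice {C = C} false rank≤))
... | inj₁ _ | inj₂ C⁻≡∅ = subst (_≤ 2 ^ k) (sym (card-slice-only C true C⁻≡∅))
                                 (card≤2^rank n k _ (rankAtMostᶠ-slice {C = C} true rank≤))
... | inj₁ (x , Cx) | inj₁ (y , Cy) = bothSlices k rank≤
  where
  bothSlices : ∀ k → RankAtMostᶠ C (suc k) → card C ≤ 2 ^ k
  bothSlices zero    rank≤ = ⊥-elim (rankAtMostᶠ-0⇒empty (rankAtMostᶠ-slice-opposite {C = C} true y Cy rank≤) x Cx)
  bothSlices (suc k) rank≤ = subst (_≤ 2 ^ suc k) (sym (card-slices C)) (ℕP.+-mono-≤
    (card≤2^rank n k _ (rankAtMostᶠ-slice-opposite {C = C} true y Cy rank≤))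
    (ℕP.≤-trans (card≤2^rank n k _ (rankAtMostᶠ-slice-opposite {C = C} false x Cx rank≤)) (ℕP.m≤m+n (2 ^ k) 0)))

-- The subcubes C(v; I₁, …, I_k)

module _ {n k : ℕ} (I : Fin k → Subset n) where

  BlocksNonempty : Set
  BlocksNonempty = ∀ j → ∃ λ t → lookup (I j) t ≡ true

  BlocksDisjoint : Set
  BlocksDisjoint = ∀ j j′ t → lookup (I j) t ≡ true → lookup (I j′) t ≡ true → j ≡ j′

  Uncovered : Fin n → Set
  Uncovered t = ∀ j → lookup (I j) t ≡ false

  block? : ∀ t → (∃ λ j → lookup (I j) t ≡ true) ⊎ Uncovered t
  block? t with FinP.any? (λ j → lookup (I j) t BoolP.≟ true)
  ... | yes covered = inj₁ covered
  ... | no uncovered = inj₂ λ j → BoolP.¬-not (λ t∈Iⱼ → uncovered (j , t∈Iⱼ))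

  covered⇒¬uncovered : ∀ {j t} → lookup (I j) t ≡ true → ¬ Uncovered t
  covered⇒¬uncovered {j} t∈Iⱼ uncovered with () ← trans (sym t∈Iⱼ) (uncovered j)

nonempty⇒blocksNonempty : ∀ {n k} (I : Fin k → Subset n) → (∀ j → Nonempty (I j)) → BlocksNonempty I
nonempty⇒blocksNonempty I nonempty j = proj₁ (nonempty j) , VecP.[]=⇒lookup (proj₂ (nonempty j))

blocksNonempty⇒nonempty : ∀ {n k} (I : Fin k → Subset n) → BlocksNonempty I → ∀ j → Nonempty (I j)
blocksNonempty⇒nonempty I nonempty j = proj₁ (nonempty j) , VecP.lookup⇒[]= _ (I j) (proj₂ (nonempty j))

lookup-∩ : ∀ {n} (S S′ : Subset n) t → lookup (S ∩ S′) t ≡ lookup S t ∧ lookup S′ t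
lookup-∩ S S′ t = VecP.lookup-zipWith _∧_ t S S′

disjoint⇒blocksDisjoint : ∀ {n k} (I : Fin k → Subset n) → (∀ j j′ → ¬ j ≡ j′ → Empty (I j ∩ I j′)) → BlocksDisjoint I
disjoint⇒blocksDisjoint I disjoint j j′ t t∈Iⱼ t∈Iⱼ′ with j Fin.≟ j′
... | yes j≡j′ = j≡j′
... | no  j≢j′ = ⊥-elim (disjoint j j′ j≢j′ (t , VecP.lookup⇒[]= t (I j ∩ I j′) (trans (lookup-∩ (I j) (I j′) t) (cong₂ _∧_ t∈Iⱼ t∈Iⱼ′))))

blocksDisjoint⇒disjoint : ∀ {n k} (I : Fin k → Subset n) → BlocksDisjoint I → ∀ j j′ → ¬ j ≡ j′ → Empty (I j ∩ I j′)
blocksDisjoint⇒disjoint I disjoint j j′ j≢j′ (t , t∈Iⱼ∩Iⱼ′) =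
  j≢j′ (disjoint j j′ t (proj₁ BoolP.∧-conical _ _ t∈both) (proj₂ BoolP.∧-conical _ _ t∈both))
  where t∈both = trans (sym (lookup-∩ (I j) (I j′) t)) (VecP.[]=⇒lookup t∈Iⱼ∩Iⱼ′)

-- y = ε₁ v(I₁) + ⋯ + ε_k v(I_k) + v(J), read coordinatewise on the sign vectors.
record Vertex {n k} (v : Cube n) (I : Fin k → Subset n) (ε : Fin k → Bool) (y : Cube n) : Set where
  constructor vertex
  field
    on-block   : ∀ j t → lookup (I j) t ≡ true → lookup y t ≡ xnor (ε j) (lookup v t)
    off-blocks : ∀ t → Uncovered I t → lookup y t ≡ lookup v t
open Vertex public

Vertex-ε-cong : ∀ {n k} {v : Cube n} {I : Fin k → Subset n} {ε ε′ y} → (∀ j → ε j ≡ ε′ j) → Vertex v I ε y → Vertex v I ε′ y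
Vertex-ε-cong ε≗ε′ (vertex on off) = vertex (λ j t t∈Iⱼ → trans (on j t t∈Iⱼ) (cong (λ b → xnor b _) (ε≗ε′ j))) off

Vertex-unique : ∀ {n k} {v : Cube n} {I : Fin k → Subset n} {ε y y′} → Vertex v I ε y → Vertex v I ε y′ → y ≡ y′
Vertex-unique {I = I} (vertex on off) (vertex on′ off′) = vec-ext coordinate
  where
  coordinate : ∀ t → _
  coordinate t with block? I t
  ... | inj₁ (j , t∈Iⱼ) = trans (on j t t∈Iⱼ) (sym (on′ j t t∈Iⱼ))
  ... | inj₂ uncovered  = trans (off t uncovered) (sym (off′ t uncovered))

Vertex-injective : ∀ {n k} {v : Cube n} {I : Fin k → Subset n} {ε ε′ y} → BlocksNonempty I →
  Vertex v I ε y → Vertex v I ε′ y → ∀ j → ε j ≡ ε′ j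
Vertex-injective nonempty (vertex on _) (vertex on′ _) j =
  xnor-injectiveˡ _ (trans (sym (on j t t∈Iⱼ)) (on′ j t t∈Iⱼ))
  where
  t = proj₁ (nonempty j)
  t∈Iⱼ = proj₂ (nonempty j)

module _ {n k : ℕ} (v : Cube n) (I : Fin k → Subset n) where

  vertexCoordinate : (Fin k → Bool) → (t : Fin n) → (∃ λ j → lookup (I j) t ≡ true) ⊎ Uncovered I t → Bool
  vertexCoordinate ε t (inj₁ (j , _)) = xnor (ε j) (lookup v t)
  vertexCoordinate ε t (inj₂ _)       = lookup v t

  vertexAt : (Fin k → Bool) → Cube n
  vertexAt ε = Vec.tabulate (λ t → vertexCoordinate ε t (block? I t))

  vertexAt-isVertex : BlocksDisjoint I → ∀ ε → Vertex v I ε (vertexAt ε)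
  vertexAt-isVertex disjoint ε = vertex on off
    where
    on : ∀ j t → lookup (I j) t ≡ true → lookup (vertexAt ε) t ≡ xnor (ε j) (lookup v t)
    on j t t∈Iⱼ rewrite VecP.lookup∘tabulate (λ t → vertexCoordinate ε t (block? I t)) t with block? I t
    ... | inj₁ (j′ , t∈Iⱼ′) rewrite disjoint j′ j t t∈Iⱼ′ t∈Iⱼ = refl
    ... | inj₂ uncovered = ⊥-elim (covered⇒¬uncovered I t∈Iⱼ uncovered)
    off : ∀ t → Uncovered I t → lookup (vertexAt ε) t ≡ lookup v t
    off t uncovered rewrite VecP.lookup∘tabulate (λ t → vertexCoordinate ε t (block? I t)) t with block? I t
    ... | inj₁ (j′ , t∈Iⱼ′) = ⊥-elim (covered⇒¬uncovered I t∈Iⱼ′ uncovered)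
    ... | inj₂ _ = refl

lookup-restrict-in : ∀ {n} (v : Cube n) (S : Subset n) {t} → lookup S t ≡ true → lookup (restrict v S) t ≡ sgn (lookup v t)
lookup-restrict-in v S {t} t∈S = trans (VecP.lookup∘tabulate _ t) (cong (λ b → if b then sgn (lookup v t) else 0ℚ) t∈S)

lookup-restrict-out : ∀ {n} (v : Cube n) (S : Subset n) {t} → lookup S t ≡ false → lookup (restrict v S) t ≡ 0ℚ
lookup-restrict-out v S {t} t∉S = trans (VecP.lookup∘tabulate _ t) (cong (λ b → if b then sgn (lookup v t) else 0ℚ) t∉S)

module _ {n k : ℕ} (I : Fin k → Subset n) where

  ⋃ : List (Fin k) → Subset n
  ⋃ = List.foldr (λ j acc → I j ∪ acc) Subset.⊥

  lookup-⋃-covered : ∀ {j t} L → j ∈ L → lookup (I j) t ≡ true → lookup (⋃ L) t ≡ true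
  lookup-⋃-covered {t = t} (j ∷ L) (here refl) t∈Iⱼ =
    trans (VecP.lookup-zipWith _∨_ t (I j) (⋃ L)) (cong (_∨ lookup (⋃ L) t) t∈Iⱼ)
  lookup-⋃-covered {t = t} (i ∷ L) (there j∈L) t∈Iⱼ =
    trans (VecP.lookup-zipWith _∨_ t (I i) (⋃ L)) (trans (cong (lookup (I i) t ∨_) (lookup-⋃-covered L j∈L t∈Iⱼ)) (BoolP.∨-zeroʳ _))

  lookup-⋃-uncovered : ∀ {t} L → Uncovered I t → lookup (⋃ L) t ≡ false
  lookup-⋃-uncovered {t} []      _         = VecP.lookup-replicate t false
  lookup-⋃-uncovered {t} (i ∷ L) uncovered =
    trans (VecP.lookup-zipWith _∨_ t (I i) (⋃ L)) (cong₂ _∨_ (uncovered i) (lookup-⋃-uncovered L uncovered))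

module _ {n k : ℕ} (v : Cube n) (I : Fin k → Subset n) (ε : Fin k → Bool) where

  private
    J : Subset n
    J = ∁ (⋃ I (List.allFin k))

  lookup-blockSum : ∀ {m} (f : Fin m → Fin k) (base : Vec ℚ n) t →
    lookup (List.foldr (λ j acc → (sgn (ε j) ·V restrict v (I j)) +V acc) base (List.tabulate f)) t ≡
    ∑[ i < m ] (sgn (ε (f i)) * lookup (restrict v (I (f i))) t) + lookup base t
  lookup-blockSum {zero}  f base t = sym (ℚP.+-identityˡ _)
  lookup-blockSum {suc m} f base t = begin
    lookup ((sgn (ε (f zero)) ·V restrict v (I (f zero))) +V rest) t
      ≡⟨ VecP.lookup-zipWith _+_ t (sgn (ε (f zero)) ·V restrict v (I (f zero))) rest ⟩
    lookup (sgn (ε (f zero)) ·V restrict v (I (f zero))) t + lookup rest t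
      ≡⟨ cong₂ _+_ (VecP.lookup-map t (sgn (ε (f zero)) *_) (restrict v (I (f zero)))) (lookup-blockSum (f ∘ suc) base t) ⟩
    a + (s + lookup base t)
      ≡⟨ sym (ℚP.+-assoc a s (lookup base t)) ⟩
    (a + s) + lookup base t ∎
    where
    rest = List.foldr (λ j acc → (sgn (ε j) ·V restrict v (I j)) +V acc) base (List.tabulate (f ∘ suc))
    a = sgn (ε (f zero)) * lookup (restrict v (I (f zero))) t
    s = ∑[ i < m ] (sgn (ε (f (suc i))) * lookup (restrict v (I (f (suc i)))) t)

  lookup-subcubePoint-covered : BlocksDisjoint I → ∀ {j t} → lookup (I j) t ≡ true →
    lookup (subcubePoint v I ε) t ≡ sgn (ε j) * sgn (lookup v t)
  lookup-subcubePoint-covered disjoint {j} {t} t∈Iⱼ = begin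
    lookup (subcubePoint v I ε) t
      ≡⟨ lookup-blockSum (λ i → i) _ t ⟩
    ∑[ i < k ] (sgn (ε i) * lookup (restrict v (I i)) t) + lookup (restrict v J) t
      ≡⟨ cong₂ _+_ (sum-delta (λ i → sgn (ε i) * lookup (restrict v (I i)) t) j otherBlocks) (lookup-restrict-out v J outsideJ) ⟩
    sgn (ε j) * lookup (restrict v (I j)) t + 0ℚ
      ≡⟨ trans (ℚP.+-identityʳ _) (cong (sgn (ε j) *_) (lookup-restrict-in v (I j) t∈Iⱼ)) ⟩
    sgn (ε j) * sgn (lookup v t) ∎
    where
    otherBlocks : ∀ i → i ≢ j → sgn (ε i) * lookup (restrict v (I i)) t ≡ 0ℚ
    otherBlocks i i≢j with lookup (I i) t in t∈?Iᵢ
    ... | true  = ⊥-elim (i≢j (disjoint i j t t∈?Iᵢ t∈Iⱼ))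
    ... | false = trans (cong (sgn (ε i) *_) (lookup-restrict-out v (I i) t∈?Iᵢ)) (ℚP.*-zeroʳ (sgn (ε i)))
    outsideJ : lookup J t ≡ false
    outsideJ = trans (VecP.lookup-map t not (⋃ I (List.allFin k))) (cong not (lookup-⋃-covered I (List.allFin k) (∈P.∈-allFin j) t∈Iⱼ))

  lookup-subcubePoint-uncovered : ∀ {t} → Uncovered I t → lookup (subcubePoint v I ε) t ≡ sgn (lookup v t)
  lookup-subcubePoint-uncovered {t} uncovered = begin
    lookup (subcubePoint v I ε) t
      ≡⟨ lookup-blockSum (λ i → i) _ t ⟩
    ∑[ i < k ] (sgn (ε i) * lookup (restrict v (I i)) t) + lookup (restrict v J) t
      ≡⟨ cong₂ _+_ (sum-zero (λ i → trans (cong (sgn (ε i) *_) (lookup-restrict-out v (I i) (uncovered i))) (ℚP.*-zeroʳ (sgn (ε i)))))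
                   (lookup-restrict-in v J insideJ) ⟩
    0ℚ + sgn (lookup v t)
      ≡⟨ ℚP.+-identityˡ (sgn (lookup v t)) ⟩
    sgn (lookup v t) ∎
    where
    insideJ : lookup J t ≡ true
    insideJ = trans (VecP.lookup-map t not (⋃ I (List.allFin k))) (cong not (lookup-⋃-uncovered I (List.allFin k) uncovered))

InSubcubeOf⇔Vertex : ∀ {n k} (v : Cube n) (I : Fin k → Subset n) → BlocksDisjoint I →
  ∀ y → InSubcubeOf v I y ⇔ (∃ λ ε → Vertex v I ε y)
InSubcubeOf⇔Vertex v I disjoint y = mk⇔ to from
  where
  to : InSubcubeOf v I y → ∃ λ ε → Vertex v I ε y
  to (ε , y≡point) = ε , vertex on off
    where
    coordinate : ∀ t → sgn (lookup y t) ≡ lookup (subcubePoint v I ε) t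
    coordinate t = trans (sym (VecP.lookup-map t sgn y)) (cong (λ p → lookup p t) y≡point)
    on : ∀ j t → lookup (I j) t ≡ true → lookup y t ≡ xnor (ε j) (lookup v t)
    on j t t∈Iⱼ = sgn-injective (trans (coordinate t)
      (trans (lookup-subcubePoint-covered v I ε disjoint t∈Iⱼ) (sym (sgn-xnor (ε j) (lookup v t)))))
    off : ∀ t → Uncovered I t → lookup y t ≡ lookup v t
    off t uncovered = sgn-injective (trans (coordinate t) (lookup-subcubePoint-uncovered v I ε uncovered))
  from : (∃ λ ε → Vertex v I ε y) → InSubcubeOf v I y
  from (ε , vertex on off) = ε , vec-ext coordinate
    where
    coordinate : ∀ t → lookup (pt y) t ≡ lookup (subcubePoint v I ε) t
    coordinate t with block? I t
    ... | inj₁ (j , t∈Iⱼ) = trans (VecP.lookup-map t sgn y) (trans (cong sgn (on j t t∈Iⱼ))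
          (trans (sgn-xnor (ε j) (lookup v t)) (sym (lookup-subcubePoint-covered v I ε disjoint t∈Iⱼ))))
    ... | inj₂ uncovered = trans (VecP.lookup-map t sgn y) (trans (cong sgn (off t uncovered))
          (sym (lookup-subcubePoint-uncovered v I ε uncovered)))

=ᶜ-sound : ∀ {n} {x y : Cube n} → x =ᶜ y ≡ true → x ≡ y
=ᶜ-sound x=y = toWitness (Equivalence.from BoolP.T-≡ x=y)

=ᶜ-refl : ∀ {n} (x : Cube n) → x =ᶜ x ≡ true
=ᶜ-refl x = trans (isYes≗does (VecP.≡-dec BoolP._≟_ x x)) (dec-true (VecP.≡-dec BoolP._≟_ x x) refl)

Elem-≡ : ∀ {n} {C : CubeSet n} {a b : Elem C} → proj₁ a ≡ proj₁ b → a ≡ b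
Elem-≡ {a = y , p} {.y , q} refl = cong (y ,_) (Decidable⇒UIP.≡-irrelevant BoolP._≟_ p q)

standardBasis : ∀ k → Fin (suc k) → Cube k
standardBasis k zero    = Vec.replicate k true
standardBasis k (suc j) = Vec.replicate k true Vec.[ j ]≔ false

standardBasis-indep : ∀ k → Indepᶠ (standardBasis k)
standardBasis-indep k c Σc≡0 Σcb≡0 = c≡0
  where
  defect : Fin (suc k) → Fin k → ℚ
  defect i t = 1ℚ - sgn (lookup (standardBasis k i) t)
  defect-others : ∀ t i → i ≢ suc t → defect i t ≡ 0ℚ
  defect-others t zero    _     = cong (λ b → 1ℚ - sgn b) (VecP.lookup-replicate t true)
  defect-others t (suc j) sj≢st = cong (λ b → 1ℚ - sgn b)
    (trans (VecP.lookup∘update′ (λ t≡j → sj≢st (cong suc (sym t≡j))) (Vec.replicate k true) false) (VecP.lookup-replicate t true))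
  defect-self : ∀ t → defect (suc t) t ≡ 1ℚ + 1ℚ
  defect-self t = cong (λ b → 1ℚ - sgn b) (VecP.lookup∘update t (Vec.replicate k true) false)
  Σc·defect≡0 : ∀ t → ∑[ i < suc k ] (c i * defect i t) ≡ 0ℚ
  Σc·defect≡0 t = begin
    ∑[ i < suc k ] (c i * defect i t)
      ≡⟨ sum-cong-≗ (λ i → solve 2 (λ c s → c :* (con 1ℚ :- s) := c :+ (:- con 1ℚ) :* (c :* s)) refl (c i) (b i)) ⟩
    ∑[ i < suc k ] (c i + (- 1ℚ) * (c i * b i))
      ≡⟨ ∑-distrib-+ c (λ i → (- 1ℚ) * (c i * b i)) ⟩
    sum c + ∑[ i < suc k ] ((- 1ℚ) * (c i * b i))
      ≡⟨ cong₂ _+_ Σc≡0 (sym (*-distribˡ-sum (- 1ℚ) (λ i → c i * b i))) ⟩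
    0ℚ + (- 1ℚ) * ∑[ i < suc k ] (c i * b i)
      ≡⟨ cong (λ z → 0ℚ + (- 1ℚ) * z) (Σcb≡0 t) ⟩
    0ℚ ∎
    where
    b : Fin (suc k) → ℚ
    b i = sgn (lookup (standardBasis k i) t)
  flipped≡0 : ∀ t → c (suc t) ≡ 0ℚ
  flipped≡0 t = x+x≡0⇒x≡0 (c (suc t)) (begin
    c (suc t) + c (suc t)               ≡⟨ solve 1 (λ x → x :+ x := x :* (con 1ℚ :+ con 1ℚ)) refl (c (suc t)) ⟩
    c (suc t) * (1ℚ + 1ℚ)               ≡⟨ cong (c (suc t) *_) (sym (defect-self t)) ⟩
    c (suc t) * defect (suc t) t        ≡⟨ sym (sum-delta (λ i → c i * defect i t) (suc t)
                                             (λ i i≢st → trans (cong (c i *_) (defect-others t i i≢st)) (ℚP.*-zeroʳ (c i)))) ⟩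
    ∑[ i < suc k ] (c i * defect i t)   ≡⟨ Σc·defect≡0 t ⟩
    0ℚ                                  ∎)
  c≡0 : ∀ i → c i ≡ 0ℚ
  c≡0 zero    = trans (sym (ℚP.+-identityʳ (c zero))) (trans (cong (c zero +_) (sym (sum-zero flipped≡0))) Σc≡0)
  c≡0 (suc t) = flipped≡0 t

record Presentation {n} (C : CubeSet n) (k : ℕ) : Set where
  field
    base     : Cube n
    blocks   : Fin k → Subset n
    nonempty : BlocksNonempty blocks
    disjoint : BlocksDisjoint blocks
    members  : ∀ y → (C y ≡ true) ⇔ (∃ λ ε → Vertex base blocks ε y)

module Parametrisation {n k : ℕ} (v : Cube n) (I : Fin k → Subset n)
                       (nonempty : BlocksNonempty I) (disjoint : BlocksDisjoint I) where

  φ : Cube k → Cube n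
  φ x = vertexAt v I (lookup x)

  φ-vertex : ∀ x → Vertex v I (lookup x) (φ x)
  φ-vertex x = vertexAt-isVertex v I disjoint (lookup x)

  φ-injective : ∀ {x x′} → φ x ≡ φ x′ → x ≡ x′
  φ-injective {x} {x′} φx≡φx′ = vec-ext (Vertex-injective nonempty (φ-vertex x) (subst (Vertex v I (lookup x′)) (sym φx≡φx′) (φ-vertex x′)))

  φ-preimage : ∀ {ε y} → Vertex v I ε y → φ (Vec.tabulate ε) ≡ y
  φ-preimage {ε} y-vertex = Vertex-unique (Vertex-ε-cong (VecP.lookup∘tabulate ε) (φ-vertex (Vec.tabulate ε))) y-vertex

  -- Coordinates of φ x are signed copies of coordinates of x, or constants, and vice versa.
  Indepᶠ-φ : ∀ {m} (X : Fin m → Cube k) → Indepᶠ X ⇔ Indepᶠ (φ ∘ X)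
  Indepᶠ-φ X = mk⇔
    (affIndepᶠ-byColumns (λ i t → sgn (lookup (φ (X i)) t)) (λ i t → sgn (lookup (X i) t)) columnOfX)
    (affIndepᶠ-byColumns (λ i t → sgn (lookup (X i) t)) (λ i t → sgn (lookup (φ (X i)) t)) columnOfφX)
    where
    columnOfX : ∀ j → ColumnOf (λ i t → sgn (lookup (φ (X i)) t)) (λ i → sgn (lookup (X i) j))
    columnOfX j = inj₁ (t , sgn (lookup v t) , λ i → trans (sgn≡sgn*sgn-xnor (lookup (X i) j) (lookup v t))
                    (cong (λ b → sgn (lookup v t) * sgn b) (sym (on-block (φ-vertex (X i)) j t t∈Iⱼ))))
      where
      t = proj₁ (nonempty j)
      t∈Iⱼ = proj₂ (nonempty j)
    columnOfφX : ∀ t → ColumnOf (λ i j → sgn (lookup (X i) j)) (λ i → sgn (lookup (φ (X i)) t))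
    columnOfφX t with block? I t
    ... | inj₁ (j , t∈Iⱼ) = inj₁ (j , sgn (lookup v t) , λ i → trans (cong sgn (on-block (φ-vertex (X i)) j t t∈Iⱼ))
            (trans (sgn-xnor (lookup (X i) j) (lookup v t)) (ℚP.*-comm (sgn (lookup (X i) j)) (sgn (lookup v t)))))
    ... | inj₂ uncovered = inj₂ (sgn (lookup v t) , λ i → cong sgn (off-blocks (φ-vertex (X i)) t uncovered))

  basis : Fin (suc k) → Cube n
  basis = φ ∘ standardBasis k

  basis-indep : Indepᶠ basis
  basis-indep = Equivalence.to (Indepᶠ-φ (standardBasis k)) (standardBasis-indep k)

  module _ {m} (X : Fin m → Cube k) (d : Fin m → ℚ) (a : Fin n → ℚ)
           (balanced : ∀ t → a t + ∑[ i < m ] (d i * sgn (lookup (φ (X i)) t)) ≡ 0ℚ) where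

    balance-on-block : ∀ j t → lookup (I j) t ≡ true → a t * sgn (lookup v t) ≡ - ∑[ i < m ] (d i * sgn (lookup (X i) j))
    balance-on-block j t t∈Iⱼ = begin
      a t * sgn (lookup v t)                   ≡⟨ solve 3 (λ a s ν → a :* s := (a :+ s :* ν) :* s :- ν :* (s :* s)) refl (a t) s ν ⟩
      (a t + s * ν) * s - ν * (s * s)          ≡⟨ cong₂ (λ x y → x * s - ν * y) (trans (cong (a t +_) (sym Σ≡sν)) (balanced t)) (sgn*sgn≡1 (lookup v t)) ⟩
      0ℚ * s - ν * 1ℚ                          ≡⟨ solve 2 (λ s ν → con 0ℚ :* s :- ν :* con 1ℚ := :- ν) refl s ν ⟩
      - ν                                      ∎
      where
      s = sgn (lookup v t)
      ν = ∑[ i < m ] (d i * sgn (lookup (X i) j))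
      Σ≡sν : ∑[ i < m ] (d i * sgn (lookup (φ (X i)) t)) ≡ s * ν
      Σ≡sν = trans (sum-cong-≗ (λ i → trans (cong (λ b → d i * sgn b) (on-block (φ-vertex (X i)) j t t∈Iⱼ))
               (trans (cong (d i *_) (sgn-xnor (lookup (X i) j) (lookup v t)))
                 (solve 3 (λ d e s → d :* (e :* s) := s :* (d :* e)) refl (d i) (sgn (lookup (X i) j)) s))))
             (sym (*-distribˡ-sum s (λ i → d i * sgn (lookup (X i) j))))

    balance-off-blocks : ∀ t → Uncovered I t → a t ≡ - (sgn (lookup v t) * sum d)
    balance-off-blocks t uncovered = x+y≡0⇒x≡-y (a t) _ (trans (cong (a t +_) (sym Σ≡sΣd)) (balanced t))
      where
      Σ≡sΣd : ∑[ i < m ] (d i * sgn (lookup (φ (X i)) t)) ≡ sgn (lookup v t) * sum d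
      Σ≡sΣd = trans (sum-cong-≗ (λ i → trans (cong (λ b → d i * sgn b) (off-blocks (φ-vertex (X i)) t uncovered))
                                            (ℚP.*-comm (d i) (sgn (lookup v t)))))
                    (sym (*-distribˡ-sum (sgn (lookup v t)) d))

  decode : Cube n → Cube k
  decode y = Vec.tabulate (λ j → xnor (lookup y (proj₁ (nonempty j))) (lookup v (proj₁ (nonempty j))))

  subcubeSet : CubeSet n
  subcubeSet y = y =ᶜ φ (decode y)

  subcubeSet-presentation : Presentation subcubeSet k
  subcubeSet-presentation = record
    { base = v ; blocks = I ; nonempty = nonempty ; disjoint = disjoint ; members = members }
    where
    members : ∀ y → (subcubeSet y ≡ true) ⇔ (∃ λ ε → Vertex v I ε y)
    members y = mk⇔
      (λ y∈ → lookup (decode y) , subst (Vertex v I (lookup (decode y))) (sym (=ᶜ-sound y∈)) (φ-vertex (decode y)))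
      (λ { (ε , y-vertex) → subst (λ z → y =ᶜ z ≡ true) (sym (decode-vertex y-vertex)) (=ᶜ-refl y) })
      where
      decode-vertex : ∀ {ε} → Vertex v I ε y → φ (decode y) ≡ y
      decode-vertex {ε} y-vertex = φ-preimage (Vertex-ε-cong ε≗decode y-vertex)
        where
        ε≗decode : ∀ j → ε j ≡ xnor (lookup y (proj₁ (nonempty j))) (lookup v (proj₁ (nonempty j)))
        ε≗decode j = xnor-transpose (sym (on-block y-vertex j _ (proj₂ (nonempty j))))

module Subcube {n k : ℕ} {C : CubeSet n} (S : IsSubcube k C) where
  open Bijection (proj₁ S) using (to; injective; surjective)

  g : Cube k → Cube n
  g = proj₁ ∘ to

  g∈C : ∀ x → C (g x) ≡ true
  g∈C = proj₂ ∘ to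

  preimage : ∀ y → C y ≡ true → ∃ λ x → g x ≡ y
  preimage y y∈C = proj₁ (surjective (y , y∈C)) , cong proj₁ (proj₂ (surjective (y , y∈C)) refl)

  Indepᶠ-g : ∀ {m} (X : Fin m → Cube k) → Indepᶠ X ⇔ Indepᶠ (g ∘ X)
  Indepᶠ-g X = ⇔.trans (⇔.sym (Indep-tabulate X)) (⇔.trans (proj₂ S (List.tabulate X))
                 (subst (λ L → Indep L ⇔ Indepᶠ (g ∘ X)) (sym (ListP.map-tabulate X g)) (Indep-tabulate (g ∘ X))))

  card≡2^k : card C ≡ 2 ^ k
  card≡2^k = card-image g (λ e → injective (Elem-≡ e)) C preimage g∈C

  rank≡1+k : HasRank C (suc k)
  rank≡1+k = (List.tabulate (g ∘ standardBasis k) , AllP.tabulate⁺ (g∈C ∘ standardBasis k)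
             , Equivalence.from (Indep-tabulate (g ∘ standardBasis k)) (Equivalence.to (Indepᶠ-g (standardBasis k)) (standardBasis-indep k))
             , ListP.length-tabulate (g ∘ standardBasis k))
           , RankAtMostᶠ⇒RankAtMost rank≤
    where
    rank≤ : RankAtMostᶠ C (suc k)
    rank≤ {m} X X⊆C indep = Indepᶠ-size Y (Equivalence.from (Indepᶠ-g Y) (Indepᶠ-cong (λ i → sym (proj₂ (preimage (X i) (X⊆C i)))) indep))
      where
      Y : Fin m → Cube k
      Y i = proj₁ (preimage (X i) (X⊆C i))

module Presented {n k : ℕ} {C : CubeSet n} (P : Presentation C k) where
  open Presentation P
  open Parametrisation base blocks nonempty disjoint public

  φ∈C : ∀ x → C (φ x) ≡ true
  φ∈C x = Equivalence.from (members (φ x)) (lookup x , φ-vertex x)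

  preimage : ∀ y → C y ≡ true → ∃ λ x → φ x ≡ y
  preimage y y∈C with Equivalence.to (members y) y∈C
  ... | ε , y-vertex = Vec.tabulate ε , φ-preimage y-vertex

  isSubcube : IsSubcube k C
  isSubcube = bijection , λ L → ⇔.trans (Indep⇔Indepᶠ L) (⇔.trans (Indepᶠ-φ (List.lookup L)) (⇔.sym (Indep-map φ L)))
    where
    bijection : Cube k ⤖ Elem C
    bijection = mk⤖ {to = λ x → φ x , φ∈C x}
      ( (λ e → φ-injective (cong proj₁ e))
      , λ { (y , y∈C) → proj₁ (preimage y y∈C) , λ { refl → Elem-≡ (proj₂ (preimage y y∈C)) } })

  -- A dependency with nonzero weight on x would force x to follow the block pattern of C.
  outside-indep : ∀ x → C x ≡ false → Indepᶠ (x ∷ᶠ basis)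
  outside-indep x x∉C = Indepᶠ-∷ x basis basis-indep head≡0
    where
    head≡0 : ∀ c → sum c ≡ 0ℚ → (∀ t → ∑[ i < suc (suc k) ] (c i * sgn (lookup ((x ∷ᶠ basis) i) t)) ≡ 0ℚ) → c zero ≡ 0ℚ
    head≡0 c Σc≡0 balanced with c zero ℚP.≟ 0ℚ
    ... | yes c₀≡0 = c₀≡0
    ... | no  c₀≢0 = ⊥-elim (true≢false (trans (sym (Equivalence.from (members x) (ε , vertex on off))) x∉C))
      where
      c₀ = c zero
      a : Fin n → ℚ
      a t = c₀ * sgn (lookup x t)
      t[_] : Fin k → Fin n
      t[ j ] = proj₁ (nonempty j)
      ε : Fin k → Bool
      ε j = xnor (lookup x t[ j ]) (lookup base t[ j ])
      on : ∀ j t → lookup (blocks j) t ≡ true → lookup x t ≡ xnor (ε j) (lookup base t)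
      on j t t∈Iⱼ = xnor-transpose (c*sgn*sgn-cancel c₀ (lookup x t) (lookup base t) (lookup x t[ j ]) (lookup base t[ j ]) c₀≢0 (trans
        (balance-on-block (standardBasis k) (c ∘ suc) a balanced j t t∈Iⱼ)
        (sym (balance-on-block (standardBasis k) (c ∘ suc) a balanced j t[ j ] (proj₂ (nonempty j))))))
      off : ∀ t → Uncovered blocks t → lookup x t ≡ lookup base t
      off t uncovered = sgn-injective (*-cancelˡ-≡ c₀ _ _ c₀≢0 (begin
        c₀ * sgn (lookup x t)                   ≡⟨ balance-off-blocks (standardBasis k) (c ∘ suc) a balanced t uncovered ⟩
        - (sgn (lookup base t) * sum (c ∘ suc)) ≡⟨ cong (λ S → - (sgn (lookup base t) * S)) (x+y≡0⇒x≡-y _ c₀ (trans (ℚP.+-comm _ c₀) Σc≡0)) ⟩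
        - (sgn (lookup base t) * - c₀)          ≡⟨ solve 2 (λ s c → :- (s :* (:- c)) := c :* s) refl (sgn (lookup base t)) c₀ ⟩
        c₀ * sgn (lookup base t)                ∎))

  isFlat : IsFlat C
  isFlat x r (rankWitness , _) (_ , rank′≤) with C x in x∈?C
  ... | true  = refl
  ... | false = ⊥-elim (ℕP.<⇒≱ 1+k<r r≤1+k)
    where
    L = proj₁ rankWitness
    r≤1+k : r ≤ suc k
    r≤1+k = subst (_≤ suc k) (proj₂ (proj₂ (proj₂ rankWitness)))
              (proj₂ (Subcube.rank≡1+k isSubcube) L (proj₁ (proj₂ rankWitness)) (proj₁ (proj₂ (proj₂ rankWitness))))
    inserted : ∀ i → insert x C ((x ∷ᶠ basis) i) ≡ true
    inserted zero    = cong (_∨ C x) (=ᶜ-refl x)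
    inserted (suc i) = trans (cong (_ ∨_) (φ∈C (standardBasis k i))) (BoolP.∨-zeroʳ _)
    1+k<r : suc k < r
    1+k<r = RankAtMost⇒RankAtMostᶠ rank′≤ (x ∷ᶠ basis) inserted (outside-indep x x∈?C)

-- The structure theorem

module _ {n k : ℕ} {y y′ : Cube n} {I : Fin k → Subset n} {ε₀ : Fin k → Bool} (y′-vertex : Vertex y I ε₀ y′) where

  Vertex-sym : Vertex y′ I ε₀ y
  Vertex-sym = vertex
    (λ j t t∈Iⱼ → trans (sym (xnor-involutive (ε₀ j) (lookup y t))) (cong (xnor (ε₀ j)) (sym (on-block y′-vertex j t t∈Iⱼ))))
    (λ t uncovered → sym (off-blocks y′-vertex t uncovered))

  Vertex-rebase : ∀ {ε z} → Vertex y I ε z → Vertex y′ I (λ j → xnor (ε j) (ε₀ j)) z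
  Vertex-rebase {ε} (vertex on off) = vertex
    (λ j t t∈Iⱼ → trans (on j t t∈Iⱼ) (trans (sym (xnor-cancel-middle (ε j) (ε₀ j) (lookup y t)))
                                              (cong (xnor (xnor (ε j) (ε₀ j))) (sym (on-block y′-vertex j t t∈Iⱼ)))))
    (λ t uncovered → trans (off t uncovered) (sym (off-blocks y′-vertex t uncovered)))

∃Vertex-rebase : ∀ {n k} {y y′ : Cube n} {I : Fin k → Subset n} {ε₀} → Vertex y I ε₀ y′ →
  ∀ z → (∃ λ ε → Vertex y I ε z) ⇔ (∃ λ ε → Vertex y′ I ε z)
∃Vertex-rebase y′-vertex z = mk⇔ (λ { (ε , z-vertex) → _ , Vertex-rebase y′-vertex z-vertex })
                                 (λ { (ε , z-vertex) → _ , Vertex-rebase (Vertex-sym y′-vertex) z-vertex })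

Presentation-fixedFirst : ∀ {n k} (C : CubeSet (suc n)) (b : Bool) → Presentation (slice b C) k →
  (∀ y → slice (not b) C y ≡ false) → Presentation C k
Presentation-fixedFirst {n} {k} C b P others≡∅ = record
  { base = b ∷ base ; blocks = I′ ; nonempty = nonempty′ ; disjoint = disjoint′ ; members = members′ }
  where
  open Presentation P
  I′ : Fin k → Subset (suc n)
  I′ j = false ∷ blocks j
  nonempty′ : BlocksNonempty I′
  nonempty′ j = suc (proj₁ (nonempty j)) , proj₂ (nonempty j)
  disjoint′ : BlocksDisjoint I′
  disjoint′ j j′ (suc t) = disjoint j j′ t
  lift : ∀ {ε y} → Vertex base blocks ε y → Vertex (b ∷ base) I′ ε (b ∷ y)
  lift (vertex on off) = vertex (λ { j (suc t) → on j t }) (λ { zero _ → refl ; (suc t) uncovered → off t uncovered })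
  members′ : ∀ x → (C x ≡ true) ⇔ (∃ λ ε → Vertex (b ∷ base) I′ ε x)
  members′ (b′ ∷ y) with b′ BoolP.≟ b
  ... | yes refl = mk⇔ (λ x∈C → let (ε , y-vertex) = Equivalence.to (members y) x∈C in ε , lift y-vertex)
                       (λ { (ε , vertex on off) → Equivalence.from (members y) (ε , vertex (λ j t → on j (suc t)) (λ t → off (suc t))) })
  ... | no b′≢b  = mk⇔ (λ x∈C → ⊥-elim (true≢false (trans (sym x∈C) (trans (cong (λ c → C (c ∷ y)) (BoolP.¬-not b′≢b)) (others≡∅ y)))))
                       (λ { (ε , vertex _ off) → ⊥-elim (b′≢b (off zero (λ _ → refl))) })

-- The new block consists of the first coordinate and the coordinates where the two bases differ.
module Glue {n k : ℕ} (C : CubeSet (suc n)) (v w : Cube n) (I : Fin k → Subset n)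
            (nonempty : BlocksNonempty I) (disjoint : BlocksDisjoint I)
            (agree : ∀ j t → lookup (I j) t ≡ true → lookup w t ≡ lookup v t)
            (members⁺ : ∀ y → (C (true ∷ y) ≡ true) ⇔ (∃ λ ε → Vertex v I ε y))
            (members⁻ : ∀ y → (C (false ∷ y) ≡ true) ⇔ (∃ λ ε → Vertex w I ε y)) where

  differ : Subset n
  differ = Vec.tabulate (λ t → not (xnor (lookup w t) (lookup v t)))

  I′ : Fin (suc k) → Subset (suc n)
  I′ zero    = true ∷ differ
  I′ (suc j) = false ∷ I j

  base : Bool → Cube n
  base true  = v
  base false = w

  base-differ : ∀ b t → lookup differ t ≡ true → lookup (base b) t ≡ xnor b (lookup v t)
  base-differ true  t _     = refl
  base-differ false t t∈Δ = xnor-transpose (BoolP.not-injective (trans (sym (VecP.lookup∘tabulate _ t)) t∈Δ))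

  base-same : ∀ b t → lookup differ t ≡ false → lookup (base b) t ≡ lookup v t
  base-same true  t _     = refl
  base-same false t t∉Δ = xnor-transpose (BoolP.not-injective (trans (sym (VecP.lookup∘tabulate _ t)) t∉Δ))

  base-on-block : ∀ b j t → lookup (I j) t ≡ true → lookup (base b) t ≡ lookup v t
  base-on-block true  j t _    = refl
  base-on-block false j t t∈Iⱼ = agree j t t∈Iⱼ

  covered⇒same : ∀ j t → lookup (I j) t ≡ true → lookup differ t ≡ false
  covered⇒same j t t∈Iⱼ = trans (VecP.lookup∘tabulate _ t) (cong not (trans (cong (λ c → xnor c (lookup v t)) (agree j t t∈Iⱼ)) (xnor-self (lookup v t))))

  nonempty′ : BlocksNonempty I′
  nonempty′ zero    = zero , refl
  nonempty′ (suc j) = suc (proj₁ (nonempty j)) , proj₂ (nonempty j)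

  disjoint′ : BlocksDisjoint I′
  disjoint′ zero    zero     _       _    _     = refl
  disjoint′ zero    (suc j′) (suc t) t∈Δ t∈Iⱼ′ = ⊥-elim (true≢false (trans (sym t∈Δ) (covered⇒same j′ t t∈Iⱼ′)))
  disjoint′ (suc j) zero     (suc t) t∈Iⱼ t∈Δ  = ⊥-elim (true≢false (trans (sym t∈Δ) (covered⇒same j t t∈Iⱼ)))
  disjoint′ (suc j) (suc j′) (suc t) t∈Iⱼ t∈Iⱼ′ = cong suc (disjoint j j′ t t∈Iⱼ t∈Iⱼ′)

  lift : ∀ b {ε x} → Vertex (base b) I ε x → Vertex (true ∷ v) I′ (b ∷ᶠ ε) (b ∷ x)
  lift b {ε} {x} (vertex on off) = vertex on′ off′
    where
    on′ : ∀ j t → lookup (I′ j) t ≡ true → lookup (b ∷ x) t ≡ xnor ((b ∷ᶠ ε) j) (lookup (true ∷ v) t)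
    on′ zero    zero    _    = sym (xnor-identityʳ b)
    on′ zero    (suc t) t∈Δ  = trans (off t (λ j → BoolP.¬-not (λ t∈Iⱼ → true≢false (trans (sym t∈Δ) (covered⇒same j t t∈Iⱼ)))))
                                     (base-differ b t t∈Δ)
    on′ (suc j) (suc t) t∈Iⱼ = trans (on j t t∈Iⱼ) (cong (xnor (ε j)) (base-on-block b j t t∈Iⱼ))
    off′ : ∀ t → Uncovered I′ t → lookup (b ∷ x) t ≡ lookup (true ∷ v) t
    off′ zero    uncovered = ⊥-elim (true≢false (uncovered zero))
    off′ (suc t) uncovered = trans (off t (uncovered ∘ suc)) (base-same b t (uncovered zero))

  lower : ∀ b {ε′ x} → Vertex (true ∷ v) I′ ε′ (b ∷ x) → Vertex (base b) I (ε′ ∘ suc) x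
  lower b {ε′} {x} (vertex on off) = vertex on′ off′
    where
    on′ : ∀ j t → lookup (I j) t ≡ true → lookup x t ≡ xnor (ε′ (suc j)) (lookup (base b) t)
    on′ j t t∈Iⱼ = trans (on (suc j) (suc t) t∈Iⱼ) (cong (xnor (ε′ (suc j))) (sym (base-on-block b j t t∈Iⱼ)))
    b≡ε′₀ : b ≡ ε′ zero
    b≡ε′₀ = trans (on zero zero refl) (xnor-identityʳ (ε′ zero))
    off′ : ∀ t → Uncovered I t → lookup x t ≡ lookup (base b) t
    off′ t uncovered with lookup differ t in t∈?Δ
    ... | true  = trans (on zero (suc t) t∈?Δ) (trans (cong (λ c → xnor c (lookup v t)) (sym b≡ε′₀)) (sym (base-differ b t t∈?Δ)))
    ... | false = trans (off (suc t) λ { zero → t∈?Δ ; (suc j) → uncovered j }) (sym (base-same b t t∈?Δ))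

  members : ∀ b x → (C (b ∷ x) ≡ true) ⇔ (∃ λ ε → Vertex (base b) I ε x)
  members true  = members⁺
  members false = members⁻

  presentation : Presentation C (suc k)
  presentation = record
    { base = true ∷ v ; blocks = I′ ; nonempty = nonempty′ ; disjoint = disjoint′ ; members = members′ }
    where
    members′ : ∀ x → (C x ≡ true) ⇔ (∃ λ ε → Vertex (true ∷ v) I′ ε x)
    members′ (b ∷ x) = mk⇔
      (λ x∈C → let (ε , x-vertex) = Equivalence.to (members b x) x∈C in b ∷ᶠ ε , lift b x-vertex)
      (λ { (ε′ , x-vertex) → Equivalence.from (members b x) (ε′ ∘ suc , lower b x-vertex) })

module Step {n k : ℕ} (C : CubeSet (suc n)) (rank≤ : RankAtMostᶠ C (suc (suc k)))
            (y : Cube n) (y∈C⁻ : C (false ∷ y) ≡ true)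
            (P⁺ : Presentation (slice true C) k) (card⁻ : card (slice false C) ≡ 2 ^ k) where
  open Presentation P⁺ renaming (base to v; blocks to I)
  open Presented P⁺ using (φ; φ∈C; basis; basis-indep; balance-on-block; balance-off-blocks)

  Δ : Cube n → Fin n → ℚ
  Δ z t = (sgn (lookup z t) - sgn (lookup y t)) * sgn (lookup v t)

  record Aligned (z : Cube n) : Set where
    field
      Δ-on-block        : ∀ j t t′ → lookup (I j) t ≡ true → lookup (I j) t′ ≡ true → Δ z t ≡ Δ z t′
      agrees-off-blocks : ∀ t → Uncovered I t → lookup z t ≡ lookup y t
  open Aligned

  probe : Cube n → Fin (suc (suc (suc k))) → Cube (suc n)
  probe z = (false ∷ z) ∷ᶠ ((false ∷ y) ∷ᶠ (λ i → true ∷ basis i))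

  dependency⇒aligned : ∀ z (c : Fin (suc (suc (suc k))) → ℚ) → sum c ≡ 0ℚ →
    (∀ t → ∑[ i < suc (suc (suc k)) ] (c i * sgn (lookup (probe z i) t)) ≡ 0ℚ) → c zero ≢ 0ℚ → Aligned z
  dependency⇒aligned z c Σc≡0 comb≡0 cz≢0 = record { Δ-on-block = on ; agrees-off-blocks = off }
    where
    cz = c zero
    cy = c (suc zero)
    d : Fin (suc k) → ℚ
    d i = c (suc (suc i))
    first : cz * (- 1ℚ) + (cy * (- 1ℚ) + sum d) ≡ 0ℚ
    first = trans (cong (λ s → cz * (- 1ℚ) + (cy * (- 1ℚ) + s)) (sym (sum-cong-≗ (λ i → ℚP.*-identityʳ (d i))))) (comb≡0 zero)
    Σd≡0 : sum d ≡ 0ℚ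
    Σd≡0 = x+x≡0⇒x≡0 (sum d) (trans (solve 3 (λ a b s → s :+ s := (a :+ (b :+ s)) :+ (a :* (:- con 1ℚ) :+ (b :* (:- con 1ℚ) :+ s))) refl cz cy (sum d))
             (trans (cong₂ _+_ Σc≡0 first) (ℚP.+-identityˡ 0ℚ)))
    cy≡-cz : cy ≡ - cz
    cy≡-cz = x+y≡0⇒x≡-y cy cz (trans (solve 3 (λ a b s → b :+ a := (a :+ (b :+ s)) :- s) refl cz cy (sum d)) (cong₂ _-_ Σc≡0 Σd≡0))
    a : Fin n → ℚ
    a t = cz * (sgn (lookup z t) - sgn (lookup y t))
    balanced : ∀ t → a t + ∑[ i < suc k ] (d i * sgn (lookup (φ (standardBasis k i)) t)) ≡ 0ℚ
    balanced t = begin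
      a t + Sᵦ                                          ≡⟨ cong (_+ Sᵦ) (solve 3 (λ c a b → c :* (a :- b) := c :* a :+ (:- c) :* b) refl cz (sgn (lookup z t)) (sgn (lookup y t))) ⟩
      (cz * sgn (lookup z t) + - cz * sgn (lookup y t)) + Sᵦ ≡⟨ cong (λ c → (cz * sgn (lookup z t) + c * sgn (lookup y t)) + Sᵦ) (sym cy≡-cz) ⟩
      (cz * sgn (lookup z t) + cy * sgn (lookup y t)) + Sᵦ   ≡⟨ ℚP.+-assoc (cz * sgn (lookup z t)) (cy * sgn (lookup y t)) Sᵦ ⟩
      cz * sgn (lookup z t) + (cy * sgn (lookup y t) + Sᵦ)   ≡⟨ comb≡0 (suc t) ⟩
      0ℚ                                               ∎
      where Sᵦ = ∑[ i < suc k ] (d i * sgn (lookup (φ (standardBasis k i)) t))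
    cz*Δ : ∀ j t → lookup (I j) t ≡ true → cz * Δ z t ≡ - ∑[ i < suc k ] (d i * sgn (lookup (standardBasis k i) j))
    cz*Δ j t t∈Iⱼ = trans (sym (ℚP.*-assoc cz (sgn (lookup z t) - sgn (lookup y t)) (sgn (lookup v t)))) (balance-on-block (standardBasis k) d a balanced j t t∈Iⱼ)
    on : ∀ j t t′ → lookup (I j) t ≡ true → lookup (I j) t′ ≡ true → Δ z t ≡ Δ z t′
    on j t t′ t∈Iⱼ t′∈Iⱼ = *-cancelˡ-≡ cz _ _ cz≢0 (trans (cz*Δ j t t∈Iⱼ) (sym (cz*Δ j t′ t′∈Iⱼ)))
    off : ∀ t → Uncovered I t → lookup z t ≡ lookup y t
    off t uncovered = sgn-injective (x-y≡0⇒x≡y _ _ (*-cancelˡ-≡0 cz _ cz≢0 (begin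
      a t                                 ≡⟨ balance-off-blocks (standardBasis k) d a balanced t uncovered ⟩
      - (sgn (lookup v t) * sum d)        ≡⟨ cong (λ s → - (sgn (lookup v t) * s)) Σd≡0 ⟩
      - (sgn (lookup v t) * 0ℚ)           ≡⟨ cong -_ (ℚP.*-zeroʳ (sgn (lookup v t))) ⟩
      0ℚ                                  ∎)))

  -- The k + 3 probe points lie in C, of rank at most k + 2, so some affine dependency among
  -- them exists; it cannot vanish on z, as the remaining points are independent. The dependency
  -- is only available classically, hence the conclusion is drawn for decidable goals.
  by-alignment : ∀ z → C (false ∷ z) ≡ true → {G : Set} → Dec G → (Aligned z → G) → G
  by-alignment z z∈C⁻ (yes g) _ = g
  by-alignment z z∈C⁻ (no ¬g) aligned⇒g = ⊥-elim (ℕP.<-irrefl refl (rank≤ (probe z) probe⊆C probe-indep))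
    where
    probe⊆C : ∀ i → C (probe z i) ≡ true
    probe⊆C zero          = z∈C⁻
    probe⊆C (suc zero)    = y∈C⁻
    probe⊆C (suc (suc i)) = φ∈C (standardBasis k i)
    probe-indep : Indepᶠ (probe z)
    probe-indep = Indepᶠ-∷ (false ∷ z) ((false ∷ y) ∷ᶠ (λ i → true ∷ basis i)) (Indepᶠ-offFacet true y basis basis-indep) head≡0
      where
      head≡0 : ∀ c → sum c ≡ 0ℚ → (∀ t → ∑[ i < suc (suc (suc k)) ] (c i * sgn (lookup (probe z i) t)) ≡ 0ℚ) → c zero ≡ 0ℚ
      head≡0 c Σc≡0 comb≡0 with c zero ℚP.≟ 0ℚ
      ... | yes cz≡0 = cz≡0
      ... | no  cz≢0 = ⊥-elim (¬g (aligned⇒g (dependency⇒aligned z c Σc≡0 comb≡0 cz≢0)))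

  t[_] : Fin k → Fin n
  t[ j ] = proj₁ (nonempty j)

  lower⊆ : ∀ z → C (false ∷ z) ≡ true → ∃ λ ε → Vertex y I ε z
  lower⊆ z z∈C⁻ = ε , vertex on off
    where
    ε : Fin k → Bool
    ε j = xnor (lookup z t[ j ]) (lookup y t[ j ])
    on : ∀ j t → lookup (I j) t ≡ true → lookup z t ≡ xnor (ε j) (lookup y t)
    on j t t∈Iⱼ = by-alignment z z∈C⁻ (lookup z t BoolP.≟ xnor (ε j) (lookup y t)) λ aligned →
      xnor-transpose (sgn-difference-xnor (lookup z t) (lookup y t) (lookup v t) (lookup z t[ j ]) (lookup y t[ j ]) (lookup v t[ j ]) (Δ-on-block aligned j t t[ j ] t∈Iⱼ (proj₂ (nonempty j))))
    off : ∀ t → Uncovered I t → lookup z t ≡ lookup y t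
    off t uncovered = by-alignment z z∈C⁻ (lookup z t BoolP.≟ lookup y t) λ aligned → agrees-off-blocks aligned t uncovered

  -- C⁻ lies in the subcube (y; I), which has as many points as C⁻.
  members⁻ : ∀ z → (C (false ∷ z) ≡ true) ⇔ (∃ λ ε → Vertex y I ε z)
  members⁻ z = mk⇔ (lower⊆ z) (λ z-vertex → ⊆∧card≤⇒⊇ (slice false C) subcubeSet
      (λ z′ z′∈C⁻ → Equivalence.from (members′ z′) (lower⊆ z′ z′∈C⁻))
      (ℕP.≤-reflexive (trans (Subcube.card≡2^k (Presented.isSubcube Q)) (sym card⁻)))
      z (Equivalence.from (members′ z) z-vertex))
    where
    open Parametrisation y I nonempty disjoint using (subcubeSet; subcubeSet-presentation)
    Q = subcubeSet-presentation
    open Presentation Q renaming (members to members′) using ()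

  blockSign : Fin k → Bool
  blockSign j = xnor (lookup y t[ j ]) (lookup v t[ j ])

  -- Flipping every block of y stays in C⁻; alignment of that point pins down y against v.
  y-on-block : ∀ j t → lookup (I j) t ≡ true → xnor (lookup y t) (lookup v t) ≡ blockSign j
  y-on-block j t t∈Iⱼ = by-alignment flipped flipped∈C⁻ (xnor (lookup y t) (lookup v t) BoolP.≟ blockSign j) λ aligned →
    sgn-flip-xnor (lookup y t) (lookup v t) (lookup y t[ j ]) (lookup v t[ j ]) (begin
      (sgn (not (lookup y t)) - sgn (lookup y t)) * sgn (lookup v t)   ≡⟨ cong (λ b → (sgn b - sgn (lookup y t)) * sgn (lookup v t)) (sym (flipped-on j t t∈Iⱼ)) ⟩
      Δ flipped t                                                      ≡⟨ Δ-on-block aligned j t t[ j ] t∈Iⱼ (proj₂ (nonempty j)) ⟩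
      Δ flipped t[ j ]                                                 ≡⟨ cong (λ b → (sgn b - sgn (lookup y t[ j ])) * sgn (lookup v t[ j ])) (flipped-on j t[ j ] (proj₂ (nonempty j))) ⟩
      (sgn (not (lookup y t[ j ])) - sgn (lookup y t[ j ])) * sgn (lookup v t[ j ]) ∎)
    where
    flipped = vertexAt y I (λ _ → false)
    flipped-vertex = vertexAt-isVertex y I disjoint (λ _ → false)
    flipped∈C⁻ : C (false ∷ flipped) ≡ true
    flipped∈C⁻ = Equivalence.from (members⁻ flipped) (_ , flipped-vertex)
    flipped-on : ∀ j t → lookup (I j) t ≡ true → lookup flipped t ≡ not (lookup y t)
    flipped-on j t t∈Iⱼ = on-block flipped-vertex j t t∈Iⱼ

  w : Cube n
  w = vertexAt y I blockSign

  w-vertex : Vertex y I blockSign w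
  w-vertex = vertexAt-isVertex y I disjoint blockSign

  w-agrees : ∀ j t → lookup (I j) t ≡ true → lookup w t ≡ lookup v t
  w-agrees j t t∈Iⱼ = begin
    lookup w t                                       ≡⟨ on-block w-vertex j t t∈Iⱼ ⟩
    xnor (blockSign j) (lookup y t)                  ≡⟨ cong (xnor (blockSign j)) (xnor-transpose (y-on-block j t t∈Iⱼ)) ⟩
    xnor (blockSign j) (xnor (blockSign j) (lookup v t)) ≡⟨ xnor-involutive (blockSign j) (lookup v t) ⟩
    lookup v t                                       ∎

  presentation : Presentation C (suc k)
  presentation = Glue.presentation C v w I nonempty disjoint w-agrees members
    (λ z → ⇔.trans (members⁻ z) (∃Vertex-rebase w-vertex z))

m+n≡o+o⇒m≡o : ∀ {m n o} → m ≤ o → n ≤ o → m ℕ.+ n ≡ o ℕ.+ o → m ≡ o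
m+n≡o+o⇒m≡o {m} {n} {o} m≤o n≤o e =
  ℕP.≤-antisym m≤o (ℕP.+-cancelʳ-≤ o o m (subst (_≤ m ℕ.+ o) e (ℕP.+-monoʳ-≤ m n≤o)))

structure : ∀ n k (C : CubeSet n) → RankAtMostᶠ C (suc k) → card C ≡ 2 ^ k → Presentation C k
structure zero (suc k) C _ card≡ = ⊥-elim (ℕP.<⇒≱ (ℕP.*-monoʳ-≤ 2 (ℕP.m^n>0 2 k)) (subst (_≤ 1) card≡ (card≤1 C)))
structure zero zero C _ card≡ with inhabited? C
... | inj₁ ([] , C[]) = record
  { base = [] ; blocks = λ () ; nonempty = λ () ; disjoint = λ () ; members = λ { [] → mk⇔ (λ _ → (λ ()) , vertex (λ ()) (λ ())) (λ _ → C[]) } }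
... | inj₂ C≡∅ with () ← trans (sym card≡) (card-empty C C≡∅)
structure (suc n) k C rank≤ card≡ with inhabited? (slice true C) | inhabited? (slice false C)
... | _ | inj₂ C⁻≡∅ = Presentation-fixedFirst C true
  (structure n k _ (rankAtMostᶠ-slice {C = C} true rank≤) (trans (sym (card-slice-only C true C⁻≡∅)) card≡)) C⁻≡∅
... | inj₂ C⁺≡∅ | inj₁ _ = Presentation-fixedFirst C false
  (structure n k _ (rankAtMostᶠ-slice {C = C} false rank≤) (trans (sym (card-slice-only C false C⁺≡∅)) card≡)) C⁺≡∅
... | inj₁ (x , x∈C⁺) | inj₁ (y , y∈C⁻) = bothSlices k rank≤ card≡
  where
  bothSlices : ∀ k → RankAtMostᶠ C (suc k) → card C ≡ 2 ^ k → Presentation C k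
  bothSlices zero    rank≤ _     = ⊥-elim (rankAtMostᶠ-0⇒empty (rankAtMostᶠ-slice-opposite {C = C} true y y∈C⁻ rank≤) x x∈C⁺)
  bothSlices (suc k) rank≤ card≡ = Step.presentation C rank≤ y y∈C⁻ (structure n k (slice true C) rank⁺ card⁺) card⁻
    where
    rank⁺ = rankAtMostᶠ-slice-opposite {C = C} true y y∈C⁻ rank≤
    rank⁻ = rankAtMostᶠ-slice-opposite {C = C} false x x∈C⁺ rank≤
    card⁺≤ = card≤2^rank n k (slice true C) rank⁺
    card⁻≤ = card≤2^rank n k (slice false C) rank⁻
    sum≡ : card (slice true C) ℕ.+ card (slice false C) ≡ 2 ^ k ℕ.+ 2 ^ k
    sum≡ = trans (sym (card-slices C)) (trans card≡ (cong (2 ^ k ℕ.+_) (ℕP.+-identityʳ (2 ^ k))))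
    card⁺ = m+n≡o+o⇒m≡o card⁺≤ card⁻≤ sum≡
    card⁻ = m+n≡o+o⇒m≡o card⁻≤ card⁺≤ (trans (ℕP.+-comm (card (slice false C)) _) sum≡)

standardSubcube : ∀ {n k} → k ≤ n → ∃ λ (F : CubeSet n) → Presentation F k
standardSubcube {n} {k} k≤n = subcubeSet , subcubeSet-presentation
  where
  I : Fin k → Subset n
  I j = ⁅ Fin.inject≤ j k≤n ⁆
  nonempty : BlocksNonempty I
  nonempty j = Fin.inject≤ j k≤n , VecP.[]=⇒lookup (SubsetP.x∈⁅x⁆ (Fin.inject≤ j k≤n))
  disjoint : BlocksDisjoint I
  disjoint j j′ t t∈Iⱼ t∈Iⱼ′ = FinP.inject≤-injective k≤n k≤n j j′
    (trans (sym (SubsetP.x∈⁅y⁆⇒x≡y _ (VecP.lookup⇒[]= t (I j) t∈Iⱼ))) (SubsetP.x∈⁅y⁆⇒x≡y _ (VecP.lookup⇒[]= t (I j′) t∈Iⱼ′)))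
  open Parametrisation (Vec.replicate n true) I nonempty disjoint using (subcubeSet; subcubeSet-presentation)

MaximumFlat : ∀ {n} (k : ℕ) → CubeSet n → Set
MaximumFlat {n} k C = IsFlat C × HasRank C (suc k) × (∀ (F : CubeSet n) → IsFlat F → HasRank F (suc k) → card F ≤ card C)

BlockSubcube : ∀ {n} (k : ℕ) → CubeSet n → Set
BlockSubcube {n} k C = Σ (Cube n) λ v → Σ (Fin k → Subset n) λ I →
  (∀ j → Nonempty (I j)) × (∀ j j′ → ¬ j ≡ j′ → Empty (I j ∩ I j′)) × (∀ y → (C y ≡ true) ⇔ InSubcubeOf v I y)

card∧rank⇒presentation : ∀ {n k} (C : CubeSet n) → card C ≡ 2 ^ k → HasRank C (suc k) → Presentation C k
card∧rank⇒presentation C card≡ rank≡ = structure _ _ C (RankAtMost⇒RankAtMostᶠ (proj₂ rank≡)) card≡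

isSubcube⇒presentation : ∀ {n k} (C : CubeSet n) → IsSubcube k C → Presentation C k
isSubcube⇒presentation C S = card∧rank⇒presentation C (Subcube.card≡2^k S) (Subcube.rank≡1+k S)

presentation⇒maximumFlat : ∀ {n k} (C : CubeSet n) → Presentation C k → MaximumFlat k C
presentation⇒maximumFlat {n} {k} C P = Presented.isFlat P , Subcube.rank≡1+k S , maximum
  where
  S = Presented.isSubcube P
  maximum : ∀ F → IsFlat F → HasRank F (suc k) → card F ≤ card C
  maximum F _ rank≡ = subst (card F ≤_) (sym (Subcube.card≡2^k S)) (card≤2^rank n k F (RankAtMost⇒RankAtMostᶠ (proj₂ rank≡)))

maximumFlat⇒presentation : ∀ {n k} (C : CubeSet n) → MaximumFlat k C → Presentation C k
maximumFlat⇒presentation {n} {k} C (_ , rank≡@((L , _ , L-indep , length≡) , rank≤) , maximum) =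
  card∧rank⇒presentation C (ℕP.≤-antisym card≤ card≥) rank≡
  where
  k≤n : k ≤ n
  k≤n = ℕ.s≤s⁻¹ (subst (_≤ suc n) length≡ (Indepᶠ-size (List.lookup L) (Equivalence.to (Indep⇔Indepᶠ L) L-indep)))
  F = proj₁ (standardSubcube k≤n)
  Q = proj₂ (standardSubcube k≤n)
  card≤ : card C ≤ 2 ^ k
  card≤ = card≤2^rank n k C (RankAtMost⇒RankAtMostᶠ rank≤)
  card≥ : 2 ^ k ≤ card C
  card≥ = subst (_≤ card C) (Subcube.card≡2^k (Presented.isSubcube Q))
            (maximum F (Presented.isFlat Q) (Subcube.rank≡1+k (Presented.isSubcube Q)))

presentation⇔blockSubcube : ∀ {n k} (C : CubeSet n) → Presentation C k ⇔ BlockSubcube k C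
presentation⇔blockSubcube C = mk⇔
  (λ P → let open Presentation P in
    base , blocks , blocksNonempty⇒nonempty blocks nonempty , blocksDisjoint⇒disjoint blocks disjoint
         , λ y → ⇔.trans (members y) (⇔.sym (InSubcubeOf⇔Vertex base blocks disjoint y)))
  (λ { (v , I , nonempty , disjoint , members) → let disjointᴮ = disjoint⇒blocksDisjoint I disjoint in record
    { base = v ; blocks = I ; nonempty = nonempty⇒blocksNonempty I nonempty ; disjoint = disjointᴮ
    ; members = λ y → ⇔.trans (members y) (InSubcubeOf⇔Vertex v I disjointᴮ y) } })

theorem2p1 : ∀ (n : ℕ) → 1 ≤ n → ∀ (k : ℕ) (C : CubeSet n) →
    let P1 = IsSubcube k C
        P2 = (card C ≡ 2 ^ k) × HasRank C (suc k)
        P3 = IsFlat C × HasRank C (suc k) ×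
             (∀ (F : CubeSet n) → IsFlat F → HasRank F (suc k) → card F ≤ card C)
        P4 = Σ (Cube n) λ v → Σ (Fin k → Subset n) λ I →
               (∀ j → Nonempty (I j)) ×
               (∀ j j′ → ¬ j ≡ j′ → Empty (I j ∩ I j′)) ×
               (∀ y → (C y ≡ true) ⇔ InSubcubeOf v I y)
    in (P1 ⇔ P2) × (P1 ⇔ P3) × (P1 ⇔ P4)
theorem2p1 n _ k C =
    mk⇔ (λ S → Subcube.card≡2^k S , Subcube.rank≡1+k S)
        (λ (card≡ , rank≡) → Presented.isSubcube (card∧rank⇒presentation C card≡ rank≡))
  , mk⇔ (presentation⇒maximumFlat C ∘ isSubcube⇒presentation C)
        (Presented.isSubcube ∘ maximumFlat⇒presentation C)
  , ⇔.trans (mk⇔ (isSubcube⇒presentation C) Presented.isSubcube) (presentation⇔blockSubcube C)
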